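{- For every positive integer $k$ there is $\varepsilon_0>0$, and for every $0<\varepsilon\le\varepsilon_0$ there is $L$, such that for all $\ell_0\ge L$ the following holds. Let $\ell$ be a positive integer with $\ell\le 10\ell_0$, and let $\mathbf{T}=\{T_c:c\in\Gamma\}$ be a collection of tournaments on a common vertex set $V$ with $|V|\ge\ell+\ell_0$ and $|\Gamma|\ge\ell+\ell_0$. Let $D\subseteq\Gamma$ with $|D|\le k$. Then for each $P\in\{\vec{P}_\ell,\overleftarrow{P}_\ell\}$, $\mathbf{T}$ contains a $(\Gamma\setminus D)$-near-rainbow $(P,2,50)$-broom $F$ such that every tip $v$ of $F$ satisfies $|N^{\sigma}_{T_d}(v,V\setminus V(F))|\ge\varepsilon\ell_0$ for all $d\in D$ and $\sigma\in\{+,-\}$.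
   Context: $\vec{P}_\ell$, $\overleftarrow{P}_\ell$: forward and backward directed paths of length $\ell$. For an oriented path $P=x_1\dots x_k$ ($k\ge2$) and integers $s_1,s_2$, a $(P,s_1,s_2)$-broom is obtained from $P$ by blowing up $x_1$ into $s_1$ vertices (start-tips) and $x_k$ into $s_2$ vertices (end-tips), new arcs keeping the orientation of the corresponding arc of $P$; tips are start-tips and end-tips; tip-arcs are arcs incident to tips. A coloring of a broom $F$ in $\mathbf{T}$ is a map $\varphi:E(F)\to\Gamma$ with each arc $e$ in $T_{\varphi(e)}$; it is near-rainbow if all start-tip-arcs share a color, all end-tip-arcs share a color, and every path in $F$ from a start-tip to an end-tip is rainbow (distinct colors); it is $C$-near-rainbow if additionally its image is contained in $C$. $N^{+}_{T_d}(v,X)$ and $N^-_{T_d}(v,X)$ are the out- and in-neighbours of $v$ in $T_d$ lying in $X$.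
   Formalization: The parameter ε ranges only over the rationals with 0 < ε ≤ ε₀, and the threshold ε₀ is taken rational as well. -}

module Defs where

open import Data.Nat using (ℕ; zero; suc; _∸_; _≤_)
open import Data.Nat.Properties using (_<?_)
open import Data.Fin using (Fin; zero; suc; toℕ; fromℕ<; inject₁)
open import Data.Fin.Subset using (Subset; _∈_; _∉_)
open import Data.Bool using (Bool; true; false; if_then_else_)
open import Data.Product using (Σ; ∃; _×_; _,_)
open import Data.Sum using (_⊎_)
open import Data.Integer using (+_)
open import Data.Rational using (ℚ; _/_; _*_) renaming (_≤_ to _≤ℚ_)
open import Data.Empty using (⊥)
open import Function.Definitions using (Injective)
open import Relation.Nullary using (¬_; Dec; yes; no)
open import Relation.Binary.PropositionalEquality using (_≡_; _≢_)
open import Level using (0ℓ)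

ℕtoℚ : ℕ → ℚ
ℕtoℚ n = + n / 1

record Tournament (n : ℕ) : Set₁ where
  field
    _⇒_     : Fin n → Fin n → Set
    irrefl  : ∀ u → ¬ (u ⇒ u)
    total   : ∀ u v → u ≢ v → (u ⇒ v) ⊎ (v ⇒ u)
    asym    : ∀ u v → u ⇒ v → ¬ (v ⇒ u)

open Tournament public

-- An oriented path P = x_0 x_1 ... x_ℓ of length ℓ (ℓ arcs) is
-- given by its orientation vector  dir : Fin ℓ → Bool, where dir i = true
-- means the i-th arc is x_i → x_{i+1} and false means x_{i+1} → x_i.
-- The (P,s₁,s₂)-broom has vertices: s₁ start-tips (blow-up of x_0),
-- the internal vertices x_1 … x_{ℓ-1}, and s₂ end-tips (blow-up of x_ℓ).

data BVert (ℓ s₁ s₂ : ℕ) : Set where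
  start : Fin s₁ → BVert ℓ s₁ s₂
  mid   : Fin (ℓ ∸ 1) → BVert ℓ s₁ s₂     -- mid m  is  x_{m+1}
  end   : Fin s₂ → BVert ℓ s₁ s₂

-- vertex at position j of the copy of P through start-tip a and end-tip b
pos : ∀ {ℓ s₁ s₂} → Fin s₁ → Fin s₂ → Fin (suc ℓ) → BVert ℓ s₁ s₂
pos a b zero = start a
pos {ℓ} a b (suc j) with toℕ j <? (ℓ ∸ 1)
... | yes p = mid (fromℕ< p)
... | no _  = end b

-- the i-th arc (in path order: from position i to position i+1) of the
-- copy through (a , b); every arc of the broom is of this form.
arcFrom arcTo : ∀ {ℓ s₁ s₂} → Fin s₁ → Fin s₂ → Fin ℓ → BVert ℓ s₁ s₂
arcFrom a b i = pos a b (inject₁ i)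
arcTo   a b i = pos a b (suc i)

data IsTip {ℓ s₁ s₂ : ℕ} : BVert ℓ s₁ s₂ → Set where
  start-tip : ∀ a → IsTip (start a)
  end-tip   : ∀ b → IsTip (end b)

-- Neighbourhood sizes.  |N^σ_{T}(v, V ∖ X)| ≥ x, where X is the image of f
-- and x is a rational: there are k ≥ x distinct such neighbours.

Sign : Set
Sign = Bool   -- true = out-neighbours (+), false = in-neighbours (−)

Nbr : ∀ {n} → Tournament n → Sign → Fin n → Fin n → Set
Nbr T true  v w = _⇒_ T v w
Nbr T false v w = _⇒_ T w v

NbrOutsideAtLeast : ∀ {n} {A : Set} → Tournament n → Sign → Fin n →
                    (A → Fin n) → ℚ → Set
NbrOutsideAtLeast {n} {A} T σ v f x =
  Σ ℕ λ k → (x ≤ℚ ℕtoℚ k) ×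
    Σ (Fin k → Fin n) λ g → Injective _≡_ _≡_ g ×
      (∀ t → Nbr T σ v (g t) × (∀ (y : A) → f y ≢ g t))

-- A D-avoiding near-rainbow (P,s₁,s₂)-broom in the collection T of
-- tournaments (colours Fin m, vertices Fin n), P of length ℓ with
-- orientation vector dir, whose tips all have at least x σ-neighbours
-- outside V(F) in every T_d, d ∈ D.
--   f : injective embedding of the broom's vertices into V
--   φ : colouring; the arc between consecutive vertices u , w (in path
--       order) receives colour φ u w.

record GoodBroom (n m : ℕ) (T : Fin m → Tournament n) (ℓ : ℕ)
                 (dir : Fin ℓ → Bool) (s₁ s₂ : ℕ)
                 (D : Subset m) (x : ℚ) : Set₁ where
  field
    f      : BVert ℓ s₁ s₂ → Fin n
    f-inj  : Injective _≡_ _≡_ f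
    φ      : BVert ℓ s₁ s₂ → BVert ℓ s₁ s₂ → Fin m
    arcs   : ∀ a b i →
             if dir i
               then _⇒_ (T (φ (arcFrom a b i) (arcTo a b i)))
                         (f (arcFrom a b i)) (f (arcTo a b i))
               else _⇒_ (T (φ (arcFrom a b i) (arcTo a b i)))
                         (f (arcTo a b i)) (f (arcFrom a b i))
    avoidD : ∀ a b i → φ (arcFrom a b i) (arcTo a b i) ∉ D
    startCol : Σ (Fin m) λ c → ∀ a b (i : Fin ℓ) → toℕ i ≡ 0 →
               φ (arcFrom a b i) (arcTo a b i) ≡ c
    endCol   : Σ (Fin m) λ c → ∀ a b (i : Fin ℓ) → suc (toℕ i) ≡ ℓ →
               φ (arcFrom a b i) (arcTo a b i) ≡ c
    rainbow  : ∀ a b → Injective _≡_ _≡_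
                 (λ (i : Fin ℓ) → φ (arcFrom a b i) (arcTo a b i))
    tips     : ∀ v → IsTip v → ∀ d → d ∈ D → ∀ (σ : Sign) →
               NbrOutsideAtLeast (T d) σ (f v) f x

forward backward : (ℓ : ℕ) → Fin ℓ → Bool
forward  ℓ _ = true
backward ℓ _ = false

-- A rainbow path P from u to y, with colours outside D ∪ {c_S, c_E}, is grown one vertex at a
-- time while q in-neighbours of u in T_{c_S} and q out-neighbours of y in T_{c_E} are kept off
-- P. Given two unused colours a, b, a free vertex w with u →_a w, u →_b w and w →_a y can be
-- spliced into some arc of P: walk along P while the next vertex beats w in both a and b.
-- Otherwise every free vertex precedes u in colour a or b, or follows y in colour a, so one of
-- these classes has more than 2q vertices. Since a tournament on more than 2q vertices has a
-- vertex of out-degree at least q (count arcs), P can then be extended at one end and the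
-- neighbour set at that end renewed. Counting arcs again, all but 4|D|s vertices have s in- and
-- s out-neighbours off P in every T_d; with s = t + 52 and t ≥ εℓ₀, two good in-neighbours of u
-- and fifty good out-neighbours of y become the tips. For ℓ = 1 a vertex dominating 101 good
-- vertices, and one of these dominating 50 others, give the broom in a single colour. Backward
-- brooms are forward brooms in the converse tournaments.

module Submission where

open import Defs
open import Data.Nat using (ℕ; zero; suc; _+_; _*_; _≤_; _<_; z≤n; s≤s; _<?_; _≤?_)
open import Data.Nat.Properties
  using ( +-suc; +-comm; *-identityʳ; ≤-refl; ≤-reflexive; ≤-trans; ≤-<-trans; <-≤-trans; <⇒≤
        ; <⇒≢; <⇒≱; ≮⇒≥; <-irrefl; n≤1+n; m≤m+n; m≤n*m; m<m+n; m≤n⇒m⊓n≡m; suc-injective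
        ; +-mono-≤; +-monoˡ-≤; +-monoʳ-≤; *-monoˡ-≤; *-monoʳ-≤; +-cancelˡ-≤; +-cancelʳ-≤; *-cancelˡ-≤
        ; +-commutativeSemigroup; module ≤-Reasoning )
open import Data.Nat.DivMod using (_/_; _%_; m≡m%n+[m/n]*n; m%n<n; m/n*n≤m)
open import Data.Nat.ListAction using (sum)
open import Data.Nat.Tactic.RingSolver using (solve-∀)
open import Algebra.Properties.CommutativeSemigroup +-commutativeSemigroup using (x∙yz≈y∙xz)
import Data.Nat.Coprimality as Coprime
import Data.Integer as ℤ
import Data.Integer.Properties as ℤ
open import Data.Rational using (ℚ; 0ℚ; mkℚ; NonNegative; *≤*; *<*)
  renaming (_≤_ to _≤ℚ_; _<_ to _<ℚ_; _*_ to _*ℚ_)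
import Data.Rational.Properties as ℚ
import Data.Rational.Unnormalised as ℚᵘ
import Data.Rational.Unnormalised.Properties as ℚᵘ
open import Data.Bool using (Bool; true; false)
open import Data.Fin using (Fin; zero; suc; toℕ; fromℕ; inject₁; inject≤; _≟_)
open import Data.Fin.Properties
  using (injective⇒≤; inject≤-injective; toℕ-injective; toℕ-fromℕ<; toℕ-inject₁; toℕ<n; toℕ-fromℕ)
open import Data.Fin.Relation.Unary.Top using (view; ‵fromℕ; ‵inj₁)
open import Data.Fin.Subset using (Subset; ∣_∣; inside; outside) renaming (_∈_ to _∈ₛ_; _∉_ to _∉ₛ_)
open import Data.Vec.Base using (_[_]=_)
open import Data.List using (List; []; _∷_; length; filter; lookup; allFin; tabulate; take; _++_; map)
open import Data.List.Properties using (filter-all; filter-none; length-++; length-map; length-take; length-tabulate)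
open import Data.List.Membership.Propositional using (_∈_; _∉_; find)
open import Data.List.Membership.Propositional.Properties
  using (∈-lookup; ∈-filter⁺; ∈-filter⁻; ∈-allFin; ∈-++⁺ˡ; ∈-++⁺ʳ; ∈-map⁺; ∈-tabulate⁺)
open import Data.List.Relation.Unary.Any using (Any; here; there; index; any?)
open import Data.List.Relation.Unary.Any.Properties using (lookup-index)
open import Data.List.Relation.Unary.All as All using (All; all?)
open import Data.List.Relation.Unary.All.Properties using (¬All⇒Any¬; ¬Any⇒All¬)
open import Data.List.Relation.Binary.Subset.Propositional using (_⊆_)
open import Data.List.Relation.Unary.Unique.Propositional using (Unique; _∷_)
import Data.List.Relation.Unary.Unique.Propositional.Properties as Unique
open import Data.Vec as Vec using (Vec; []; _∷_; _∷ʳ_)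
open import Data.Vec.Properties using (length-toList)
open import Data.Vec.Membership.Propositional using () renaming (_∈_ to _∈ᵥ_; _∉_ to _∉ᵥ_)
open import Data.Vec.Membership.Propositional.Properties using (∈-toList⁺; ∈-toList⁻) renaming (∈-lookup to ∈ᵥ-lookup)
open import Data.Vec.Relation.Unary.Any using (here; there)
open import Data.Product using (Σ; ∃; _×_; _,_; proj₁; proj₂)
open import Data.Sum using (_⊎_; inj₁; inj₂; [_,_]′; map₁; map₂)
open import Function using (_∘_; id)
open import Function.Definitions using (Injective)
open import Level using (0ℓ)
open import Relation.Nullary using (¬_; Dec; yes; no; contradiction)
open import Relation.Nullary.Decidable using (_×-dec_; _⊎-dec_)
open import Relation.Unary using (Pred; Decidable)
open import Relation.Unary.Properties using (∁?)
open import Relation.Binary.PropositionalEquality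
  using (_≡_; _≢_; refl; sym; trans; cong; cong₂; subst; subst₂; module ≡-Reasoning)

-- Counting in lists without repetition

module _ {A : Set} where

  lookup-injective : {xs : List A} → Unique xs → Injective _≡_ _≡_ (lookup xs)
  lookup-injective (_  ∷ _) {zero}  {zero}  _  = refl
  lookup-injective (x≢ ∷ _) {zero}  {suc j} eq = contradiction eq (All.lookup x≢ (∈-lookup j))
  lookup-injective (x≢ ∷ _) {suc i} {zero}  eq = contradiction (sym eq) (All.lookup x≢ (∈-lookup i))
  lookup-injective (_  ∷ u) {suc i} {suc j} eq = cong suc (lookup-injective u eq)

  Unique-⊆⇒length≤ : {xs ys : List A} → Unique xs → xs ⊆ ys → length xs ≤ length ys
  Unique-⊆⇒length≤ {xs} {ys} u xs⊆ys = injective⇒≤ position-injective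
    where
    position : Fin (length xs) → Fin (length ys)
    position i = index (xs⊆ys (∈-lookup i))
    position-injective : Injective _≡_ _≡_ position
    position-injective {i} {j} eq = lookup-injective u (begin
      lookup xs i             ≡⟨ lookup-index (xs⊆ys (∈-lookup i)) ⟩
      lookup ys (position i)  ≡⟨ cong (lookup ys) eq ⟩
      lookup ys (position j)  ≡⟨ sym (lookup-index (xs⊆ys (∈-lookup j))) ⟩
      lookup xs j             ∎)
      where open ≡-Reasoning

  pick : ∀ k {xs : List A} → Unique xs → k ≤ length xs →
         Σ (Fin k → A) λ g → Injective _≡_ _≡_ g × (∀ i → g i ∈ xs)
  pick k {xs} u k≤ = (λ i → lookup xs (inject≤ i k≤))
                   , (λ eq → inject≤-injective k≤ k≤ _ _ (lookup-injective u eq))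
                   , (λ i → ∈-lookup (inject≤ i k≤))

  take-⊆ : ∀ k (xs : List A) → take k xs ⊆ xs
  take-⊆ (suc k) (x ∷ xs) (here eq)  = here eq
  take-⊆ (suc k) (x ∷ xs) (there x∈) = there (take-⊆ k xs x∈)

  sublist-of-length : ∀ k {xs : List A} → Unique xs → k ≤ length xs →
                      Σ (List A) λ ys → Unique ys × length ys ≡ k × ys ⊆ xs
  sublist-of-length k {xs} u k≤ =
    take k xs , Unique.take⁺ k u , trans (length-take k xs) (m≤n⇒m⊓n≡m k≤) , take-⊆ k xs

  module _ {P : Pred A 0ℓ} (P? : Decidable P) where

    length-filter-∁ : ∀ xs → length (filter P? xs) + length (filter (∁? P?) xs) ≡ length xs
    length-filter-∁ []       = refl
    length-filter-∁ (x ∷ xs) with P? x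
    ... | yes _ = cong suc (length-filter-∁ xs)
    ... | no _  = trans (+-suc _ _) (cong suc (length-filter-∁ xs))

    length-filter<⇒∃∁ : ∀ xs → length (filter P? xs) < length xs → ∃ λ x → x ∈ xs × ¬ P x
    length-filter<⇒∃∁ xs lt with all? P? xs
    ... | yes all = contradiction (cong length (filter-all P? all)) (<⇒≢ lt)
    ... | no ¬all = find (¬All⇒Any¬ P? xs ¬all)

    length-filter-⊎ : {Q R : Pred A 0ℓ} (Q? : Decidable Q) (R? : Decidable R) {xs : List A} → Unique xs →
                      (∀ {x} → x ∈ xs → P x → Q x ⊎ R x) →
                      length (filter P? xs) ≤ length (filter Q? xs) + length (filter R? xs)
    length-filter-⊎ Q? R? {xs} u cover =
      ≤-trans (Unique-⊆⇒length≤ (Unique.filter⁺ P? u) sub) (≤-reflexive (length-++ (filter Q? xs)))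
      where
      sub : filter P? xs ⊆ filter Q? xs ++ filter R? xs
      sub x∈ with ∈-filter⁻ P? x∈
      ... | x∈xs , px = [ (λ qx → ∈-++⁺ˡ (∈-filter⁺ Q? x∈xs qx))
                        , (λ rx → ∈-++⁺ʳ (filter Q? xs) (∈-filter⁺ R? x∈xs rx)) ]′ (cover x∈xs px)

    filter-pigeonhole₃ : {Q R : Pred A 0ℓ} (Q? : Decidable Q) (R? : Decidable R) (k : ℕ) {xs : List A} →
      Unique xs → (∀ {x} → x ∈ xs → P x ⊎ Q x ⊎ R x) → 3 * k < length xs →
      k < length (filter P? xs) ⊎ k < length (filter Q? xs) ⊎ k < length (filter R? xs)
    filter-pigeonhole₃ Q? R? k {xs} u cover big
      with k <? length (filter P? xs) | k <? length (filter Q? xs) | k <? length (filter R? xs)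
    ... | yes p | _     | _     = inj₁ p
    ... | no _  | yes q | _     = inj₂ (inj₁ q)
    ... | no _  | no _  | yes r = inj₂ (inj₂ r)
    ... | no ¬p | no ¬q | no ¬r = contradiction (begin
      length xs                                                      ≤⟨ Unique-⊆⇒length≤ u sub ⟩
      length (filter P? xs ++ filter Q? xs ++ filter R? xs)          ≡⟨ length-++ (filter P? xs) ⟩
      length (filter P? xs) + length (filter Q? xs ++ filter R? xs)  ≡⟨ cong (length (filter P? xs) +_) (length-++ (filter Q? xs)) ⟩
      length (filter P? xs) + (length (filter Q? xs) + length (filter R? xs))
        ≤⟨ +-mono-≤ (≮⇒≥ ¬p) (+-mono-≤ (≮⇒≥ ¬q) (≤-trans (≮⇒≥ ¬r) (m≤m+n k 0))) ⟩
      3 * k                                                          ∎) (<⇒≱ big)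
      where
      open ≤-Reasoning
      sub : xs ⊆ filter P? xs ++ filter Q? xs ++ filter R? xs
      sub x∈ = [ (λ px → ∈-++⁺ˡ (∈-filter⁺ P? x∈ px))
               , [ (λ qx → ∈-++⁺ʳ (filter P? xs) (∈-++⁺ˡ (∈-filter⁺ Q? x∈ qx)))
                 , (λ rx → ∈-++⁺ʳ (filter P? xs) (∈-++⁺ʳ (filter Q? xs) (∈-filter⁺ R? x∈ rx))) ]′ ]′ (cover x∈)

module _ {n : ℕ} where

  open import Data.List.Membership.DecPropositional (_≟_ {n}) using (_∈?_; _∉?_)

  avoiding : List (Fin n) → List (Fin n)
  avoiding U = filter (_∉? U) (allFin n)

  avoiding-unique : (U : List (Fin n)) → Unique (avoiding U)
  avoiding-unique U = Unique.filter⁺ (_∉? U) (Unique.allFin⁺ n)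

  ∈-avoiding⁺ : {U : List (Fin n)} {x : Fin n} → x ∉ U → x ∈ avoiding U
  ∈-avoiding⁺ {U} x∉ = ∈-filter⁺ (_∉? U) (∈-allFin _) x∉

  ∈-avoiding⁻ : {U : List (Fin n)} {x : Fin n} → x ∈ avoiding U → x ∉ U
  ∈-avoiding⁻ {U} x∈ = proj₂ (∈-filter⁻ (_∉? U) {xs = allFin n} x∈)

  length-avoiding : (U : List (Fin n)) → n ≤ length (avoiding U) + length U
  length-avoiding U = begin
    n                                                         ≡⟨ sym (length-tabulate id) ⟩
    length (allFin n)                                         ≡⟨ sym (length-filter-∁ (_∈? U) (allFin n)) ⟩
    length (filter (_∈? U) (allFin n)) + length (avoiding U)  ≤⟨ +-monoˡ-≤ _ inside≤ ⟩
    length U + length (avoiding U)                            ≡⟨ +-comm (length U) _ ⟩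
    length (avoiding U) + length U                            ∎
    where
    open ≤-Reasoning
    inside≤ : length (filter (_∈? U) (allFin n)) ≤ length U
    inside≤ = Unique-⊆⇒length≤ (Unique.filter⁺ (_∈? U) (Unique.allFin⁺ n)) (proj₂ ∘ ∈-filter⁻ (_∈? U) {xs = allFin n})

  fresh-pair : (X : List (Fin n)) → 2 + length X ≤ n → ∃ λ a → ∃ λ b → a ≢ b × a ∉ X × b ∉ X
  fresh-pair X big with pick 2 (avoiding-unique X) (+-cancelʳ-≤ (length X) 2 _ (≤-trans big (length-avoiding X)))
  ... | g , g-inj , g∈ = g zero , g (suc zero) , (λ eq → contradiction (g-inj eq) λ ()) ,
                         ∈-avoiding⁻ (g∈ zero) , ∈-avoiding⁻ (g∈ (suc zero))

  disjoint-picks : ∀ k₁ k₂ {X Y : List (Fin n)} → Unique X → Unique Y → k₁ ≤ length X → k₁ + k₂ ≤ length Y →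
    Σ (Fin k₁ → Fin n) λ g → Σ (Fin k₂ → Fin n) λ h → Injective _≡_ _≡_ g × Injective _≡_ _≡_ h ×
      (∀ i → g i ∈ X) × (∀ j → h j ∈ Y) × (∀ i j → g i ≢ h j)
  disjoint-picks k₁ k₂ {X} {Y} uX uY k₁≤ k₁+k₂≤ with sublist-of-length k₁ uX k₁≤
  ... | X′ , uX′ , |X′| , X′⊆X with pick k₁ uX′ (≤-reflexive (sym |X′|)) | pick k₂ (Unique.filter⁺ (_∉? X′) uY) k₂≤
    where
    k₂≤ : k₂ ≤ length (filter (_∉? X′) Y)
    k₂≤ = +-cancelˡ-≤ k₁ k₂ _ (begin
      k₁ + k₂                                                  ≤⟨ k₁+k₂≤ ⟩
      length Y                                                 ≡⟨ sym (length-filter-∁ (_∈? X′) Y) ⟩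
      length (filter (_∈? X′) Y) + length (filter (_∉? X′) Y)  ≤⟨ +-monoˡ-≤ _ inX′ ⟩
      k₁ + length (filter (_∉? X′) Y)                          ∎)
      where
      open ≤-Reasoning
      inX′ : length (filter (_∈? X′) Y) ≤ k₁
      inX′ = ≤-trans (Unique-⊆⇒length≤ (Unique.filter⁺ (_∈? X′) uY) (proj₂ ∘ ∈-filter⁻ (_∈? X′) {xs = Y}))
                     (≤-reflexive |X′|)
  ... | g , g-inj , g∈ | h , h-inj , h∈ =
    g , h , g-inj , h-inj , X′⊆X ∘ g∈ , (proj₁ ∘ ∈-filter⁻ (_∉? X′) {xs = Y}) ∘ h∈ ,
    λ i j gi≡hj → proj₂ (∈-filter⁻ (_∉? X′) {xs = Y} (h∈ j)) (subst (_∈ X′) gi≡hj (g∈ i))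

elements : ∀ {m} → Subset m → List (Fin m)
elements []            = []
elements (inside ∷ p)  = zero ∷ map suc (elements p)
elements (outside ∷ p) = map suc (elements p)

length-elements : ∀ {m} (p : Subset m) → length (elements p) ≡ ∣ p ∣
length-elements []            = refl
length-elements (inside ∷ p)  = cong suc (trans (length-map suc (elements p)) (length-elements p))
length-elements (outside ∷ p) = trans (length-map suc (elements p)) (length-elements p)

∈-elements : ∀ {m} {p : Subset m} {d} → d ∈ₛ p → d ∈ elements p
∈-elements {p = inside ∷ _}  _[_]=_.here       = here refl
∈-elements {p = inside ∷ _}  (_[_]=_.there d∈) = there (∈-map⁺ suc (∈-elements d∈))
∈-elements {p = outside ∷ _} (_[_]=_.there d∈) = ∈-map⁺ suc (∈-elements d∈)

module _ {A : Set} where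

  ∉ᵥ-∷ : ∀ {k x y} {ys : Vec A k} → x ≢ y → x ∉ᵥ ys → x ∉ᵥ y ∷ ys
  ∉ᵥ-∷ x≢y _  (here eq)  = x≢y eq
  ∉ᵥ-∷ _   x∉ (there x∈) = x∉ x∈

  ∈ᵥ-∷ʳ⁻ : ∀ {k x y} (xs : Vec A k) → x ∈ᵥ xs ∷ʳ y → x ∈ᵥ xs ⊎ x ≡ y
  ∈ᵥ-∷ʳ⁻ []       (here eq)  = inj₂ eq
  ∈ᵥ-∷ʳ⁻ (_ ∷ xs) (here eq)  = inj₁ (here eq)
  ∈ᵥ-∷ʳ⁻ (_ ∷ xs) (there x∈) = map₁ there (∈ᵥ-∷ʳ⁻ xs x∈)

  ∉ᵥ-∷ʳ : ∀ {k x y} {xs : Vec A k} → x ∉ᵥ xs → x ≢ y → x ∉ᵥ xs ∷ʳ y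
  ∉ᵥ-∷ʳ {xs = xs} x∉ x≢y x∈ = [ x∉ , x≢y ]′ (∈ᵥ-∷ʳ⁻ xs x∈)

  ∈ᵥ-spliced : ∀ {k x u w} {vs : Vec A k} → x ∈ᵥ u ∷ w ∷ vs → x ≡ w ⊎ x ∈ᵥ u ∷ vs
  ∈ᵥ-spliced (here eq)          = inj₂ (here eq)
  ∈ᵥ-spliced (there (here eq))  = inj₁ eq
  ∈ᵥ-spliced (there (there x∈)) = inj₂ (there x∈)

  lookup-∷ʳ-inject₁ : ∀ {k} (xs : Vec A k) y i → Vec.lookup (xs ∷ʳ y) (inject₁ i) ≡ Vec.lookup xs i
  lookup-∷ʳ-inject₁ (x ∷ xs) y zero    = refl
  lookup-∷ʳ-inject₁ (x ∷ xs) y (suc i) = lookup-∷ʳ-inject₁ xs y i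

  lookup-∷ʳ-fromℕ : ∀ {k} (xs : Vec A k) y → Vec.lookup (xs ∷ʳ y) (fromℕ k) ≡ y
  lookup-∷ʳ-fromℕ []       y = refl
  lookup-∷ʳ-fromℕ (x ∷ xs) y = lookup-∷ʳ-fromℕ xs y

  lookup-[]-injective : Injective _≡_ _≡_ (Vec.lookup {A = A} [])
  lookup-[]-injective {()}

  lookup-∷-injective : ∀ {k x} {xs : Vec A k} → x ∉ᵥ xs →
                       Injective _≡_ _≡_ (Vec.lookup xs) → Injective _≡_ _≡_ (Vec.lookup (x ∷ xs))
  lookup-∷-injective                _  _   {zero}  {zero}  _  = refl
  lookup-∷-injective {xs = xs} x∉ _   {zero}  {suc j} eq = contradiction (subst (_∈ᵥ xs) (sym eq) (∈ᵥ-lookup j xs)) x∉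
  lookup-∷-injective {xs = xs} x∉ _   {suc i} {zero}  eq = contradiction (subst (_∈ᵥ xs) eq (∈ᵥ-lookup i xs)) x∉
  lookup-∷-injective                _  inj {suc i} {suc j} eq = cong suc (inj eq)

ℕtoℚ≡mkℚ : ∀ a → ℕtoℚ a ≡ mkℚ (ℤ.+ a) 0 (Coprime.sym (Coprime.1-coprimeTo a))
ℕtoℚ≡mkℚ a = ℚ.↥p/↧p≡p (mkℚ (ℤ.+ a) 0 _)

ℕtoℚ-mono : ∀ {a b} → a ≤ b → ℕtoℚ a ≤ℚ ℕtoℚ b
ℕtoℚ-mono {a} {b} a≤b rewrite ℕtoℚ≡mkℚ a | ℕtoℚ≡mkℚ b =
  *≤* (subst₂ ℤ._≤_ (sym (ℤ.*-identityʳ (ℤ.+ a))) (sym (ℤ.*-identityʳ (ℤ.+ b))) (ℤ.+≤+ a≤b))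

ℕtoℚ-nonNeg : ∀ a → NonNegative (ℕtoℚ a)
ℕtoℚ-nonNeg a rewrite ℕtoℚ≡mkℚ a = _

1/suc : ℕ → ℚ
1/suc M = mkℚ (ℤ.+ 1) M (Coprime.1-coprimeTo (suc M))

1/suc-pos : ∀ M → 0ℚ <ℚ 1/suc M
1/suc-pos M = *<* (ℤ.+<+ (s≤s z≤n))

1/suc*ℕtoℚ≤ : ∀ M a t → a ≤ suc M * t → 1/suc M *ℚ ℕtoℚ a ≤ℚ ℕtoℚ t
1/suc*ℕtoℚ≤ M a t a≤ rewrite ℕtoℚ≡mkℚ a | ℕtoℚ≡mkℚ t =
  ℚ.toℚᵘ-cancel-≤ (ℚᵘ.≤-respˡ-≃ (ℚᵘ.≃-sym (ℚ.toℚᵘ-homo-* (1/suc M) (ℕtoℚ′ a))) (ℚᵘ.*≤* cross))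
  where
  open ℤ.≤-Reasoning
  ℕtoℚ′ : ℕ → ℚ
  ℕtoℚ′ a = mkℚ (ℤ.+ a) 0 (Coprime.sym (Coprime.1-coprimeTo a))
  cross : (ℤ.+ 1 ℤ.* ℤ.+ a) ℤ.* ℤ.+ 1 ℤ.≤ ℤ.+ t ℤ.* ℤ.+ suc (M * 1)
  cross = begin
    (ℤ.+ 1 ℤ.* ℤ.+ a) ℤ.* ℤ.+ 1  ≡⟨ trans (ℤ.*-identityʳ _) (ℤ.*-identityˡ _) ⟩
    ℤ.+ a                        ≤⟨ ℤ.+≤+ a≤ ⟩
    ℤ.+ (suc M * t)              ≡⟨ ℤ.pos-* (suc M) t ⟩
    ℤ.+ suc M ℤ.* ℤ.+ t          ≡⟨ ℤ.*-comm (ℤ.+ suc M) (ℤ.+ t) ⟩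
    ℤ.+ t ℤ.* ℤ.+ suc M          ≡⟨ cong (λ z → ℤ.+ t ℤ.* ℤ.+ suc z) (sym (*-identityʳ M)) ⟩
    ℤ.+ t ℤ.* ℤ.+ suc (M * 1)    ∎

≤1/suc⇒*ℕtoℚ≤ : ∀ M {ε} a t → ε ≤ℚ 1/suc M → a ≤ suc M * t → ε *ℚ ℕtoℚ a ≤ℚ ℕtoℚ t
≤1/suc⇒*ℕtoℚ≤ M a t ε≤ a≤ =
  ℚ.≤-trans (ℚ.*-monoʳ-≤-nonNeg (ℕtoℚ a) {{ℕtoℚ-nonNeg a}} ε≤) (1/suc*ℕtoℚ≤ M a t a≤)

-- Tournaments

_∋_⇒_ : ∀ {n} → Tournament n → Fin n → Fin n → Set
T ∋ u ⇒ v = _⇒_ T u v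

converse : ∀ {n} → Tournament n → Tournament n
converse T = record
  { _⇒_    = λ u v → T ∋ v ⇒ u
  ; irrefl = irrefl T
  ; total  = λ u v u≢v → total T v u (u≢v ∘ sym)
  ; asym   = λ u v → asym T v u
  }

orient : ∀ {n} → Tournament n → Sign → Tournament n
orient T true  = T
orient T false = converse T

orient⇒Nbr : ∀ {n} (T : Tournament n) σ {v w} → orient T σ ∋ v ⇒ w → Nbr T σ v w
orient⇒Nbr T true  v⇒w = v⇒w
orient⇒Nbr T false v⇒w = v⇒w

module _ {n : ℕ} (T : Tournament n) where

  arc? : (u v : Fin n) → Dec (T ∋ u ⇒ v)
  arc? u v with u ≟ v
  ... | yes refl = no (irrefl T u)
  ... | no u≢v with total T u v u≢v
  ...   | inj₁ u⇒v = yes u⇒v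
  ...   | inj₂ v⇒u = no (asym T v u v⇒u)

  ¬⇒-flip : {u v : Fin n} → u ≢ v → ¬ (T ∋ u ⇒ v) → T ∋ v ⇒ u
  ¬⇒-flip {u} {v} u≢v ¬u⇒v with total T u v u≢v
  ... | inj₁ u⇒v = contradiction u⇒v ¬u⇒v
  ... | inj₂ v⇒u = v⇒u

  outDegree : List (Fin n) → Fin n → ℕ
  outDegree U u = length (filter (arc? u) U)

  inDegree : List (Fin n) → Fin n → ℕ
  inDegree U v = length (filter (λ u → arc? u v) U)

  arcsWithin : List (Fin n) → ℕ
  arcsWithin S = sum (map (outDegree S) S)

  outDegree-∷-self : ∀ x S → outDegree (x ∷ S) x ≡ outDegree S x
  outDegree-∷-self x S with arc? x x
  ... | yes x⇒x = contradiction x⇒x (irrefl T x)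
  ... | no _    = refl

  sum-outDegree-∷ : ∀ x S L → sum (map (outDegree (x ∷ S)) L) ≡ inDegree L x + sum (map (outDegree S) L)
  sum-outDegree-∷ x S []      = refl
  sum-outDegree-∷ x S (u ∷ L) with arc? u x
  ... | yes _ = cong suc (trans (cong (outDegree S u +_) (sum-outDegree-∷ x S L))
                                (x∙yz≈y∙xz (outDegree S u) (inDegree L x) (sum (map (outDegree S) L))))
  ... | no _  = trans (cong (outDegree S u +_) (sum-outDegree-∷ x S L))
                      (x∙yz≈y∙xz (outDegree S u) (inDegree L x) (sum (map (outDegree S) L)))

  outDegree+inDegree : ∀ {x} S → x ∉ S → outDegree S x + inDegree S x ≡ length S
  outDegree+inDegree []  _ = refl
  outDegree+inDegree {x} (y ∷ S) x∉ with arc? x y | arc? y x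
  ... | yes x⇒y | yes y⇒x = contradiction y⇒x (asym T x y x⇒y)
  ... | yes _   | no _    = cong suc (outDegree+inDegree S (x∉ ∘ there))
  ... | no _    | yes _   = trans (+-suc _ _) (cong suc (outDegree+inDegree S (x∉ ∘ there)))
  ... | no ¬x⇒y | no ¬y⇒x = contradiction (¬⇒-flip (x∉ ∘ here) ¬x⇒y) ¬y⇒x

  -- Each of the |S|(|S| - 1)/2 pairs in S spans exactly one arc.
  arcsWithin-identity : ∀ S → Unique S → 2 * arcsWithin S + length S ≡ length S * length S
  arcsWithin-identity []      _        = refl
  arcsWithin-identity (x ∷ S) (x≢ ∷ u) = begin
    2 * (outDegree (x ∷ S) x + sum (map (outDegree (x ∷ S)) S)) + suc (length S)
      ≡⟨ cong (λ z → 2 * z + suc (length S)) (cong₂ _+_ (outDegree-∷-self x S) (sum-outDegree-∷ x S S)) ⟩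
    2 * (outDegree S x + (inDegree S x + arcsWithin S)) + suc (length S)
      ≡⟨ regroup (outDegree S x) (inDegree S x) (arcsWithin S) (length S) ⟩
    2 * (outDegree S x + inDegree S x) + (2 * arcsWithin S + length S) + 1
      ≡⟨ cong₂ (λ a b → 2 * a + b + 1) (outDegree+inDegree S x∉) (arcsWithin-identity S u) ⟩
    2 * length S + length S * length S + 1
      ≡⟨ square (length S) ⟩
    suc (length S) * suc (length S) ∎
    where
    open ≡-Reasoning
    x∉ : x ∉ S
    x∉ x∈ = All.lookup x≢ x∈ refl
    regroup : ∀ o i a s → 2 * (o + (i + a)) + suc s ≡ 2 * (o + i) + (2 * a + s) + 1
    regroup = solve-∀
    square : ∀ s → 2 * s + s * s + 1 ≡ suc s * suc s
    square = solve-∀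

  sum-map-< : {A : Set} {f : A → ℕ} {c : ℕ} (L : List A) → (∀ {x} → x ∈ L → f x < c) →
              length L + sum (map f L) ≤ length L * c
  sum-map-< [] _ = z≤n
  sum-map-< {f = f} {c} (x ∷ L) bound = begin
    suc (length L + (f x + sum (map f L)))  ≡⟨ cong suc (x∙yz≈y∙xz (length L) (f x) _) ⟩
    suc (f x + (length L + sum (map f L)))  ≤⟨ +-mono-≤ (bound (here refl)) (sum-map-< L (bound ∘ there)) ⟩
    c + length L * c                        ∎
    where open ≤-Reasoning

  outDegree-mono : ∀ {B U} → Unique B → B ⊆ U → ∀ u → outDegree B u ≤ outDegree U u
  outDegree-mono {B} {U} uB B⊆U u = Unique-⊆⇒length≤ (Unique.filter⁺ (arc? u) uB) sub
    where
    sub : filter (arc? u) B ⊆ filter (arc? u) U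
    sub x∈ with ∈-filter⁻ (arc? u) {xs = B} x∈
    ... | x∈B , u⇒x = ∈-filter⁺ (arc? u) (B⊆U x∈B) u⇒x

  low-outDegree⇒small : ∀ {B} s → Unique B → (∀ {u} → u ∈ B → outDegree B u < s) → length B ≤ 2 * s
  low-outDegree⇒small {[]}        s _  _   = z≤n
  low-outDegree⇒small {B@(_ ∷ _)} s uB low = ≤-trans (n≤1+n _) (*-cancelˡ-≤ (length B) (begin
    length B * suc (length B)                   ≡⟨ e₁ (length B) ⟩
    length B * length B + length B              ≡⟨ cong (_+ length B) (sym (arcsWithin-identity B uB)) ⟩
    2 * arcsWithin B + length B + length B      ≡⟨ e₂ (arcsWithin B) (length B) ⟩
    2 * (length B + arcsWithin B)               ≤⟨ *-monoʳ-≤ 2 (sum-map-< B low) ⟩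
    2 * (length B * s)                          ≡⟨ e₃ (length B) s ⟩
    length B * (2 * s)                          ∎))
    where
    open ≤-Reasoning
    e₁ : ∀ k → k * suc k ≡ k * k + k
    e₁ = solve-∀
    e₂ : ∀ a k → 2 * a + k + k ≡ 2 * (k + a)
    e₂ = solve-∀
    e₃ : ∀ k s → 2 * (k * s) ≡ k * (2 * s)
    e₃ = solve-∀

  few-low-outDegree : ∀ {U} → Unique U → (s : ℕ) → length (filter (λ u → outDegree U u <? s) U) ≤ 2 * s
  few-low-outDegree {U} uU s = low-outDegree⇒small s uB low
    where
    B : List (Fin n)
    B = filter (λ u → outDegree U u <? s) U
    uB : Unique B
    uB = Unique.filter⁺ _ uU
    low : ∀ {u} → u ∈ B → outDegree B u < s
    low {u} u∈ = ≤-<-trans (outDegree-mono uB (proj₁ ∘ ∈-filter⁻ _ {xs = U}) u)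
                           (proj₂ (∈-filter⁻ (λ u → outDegree U u <? s) {xs = U} u∈))

  dominating-vertex : ∀ {U} q → Unique U → 2 * q < length U → ∃ λ w → w ∈ U × q ≤ outDegree U w
  dominating-vertex {U} q uU big
    with length-filter<⇒∃∁ (λ u → outDegree U u <? q) U (≤-<-trans (few-low-outDegree uU q) big)
  ... | w , w∈ , ¬out<q = w , w∈ , ≮⇒≥ ¬out<q

record OutFan {n : ℕ} (T : Tournament n) (w : Fin n) (q : ℕ) : Set where
  field
    members : List (Fin n)
    unique  : Unique members
    size    : length members ≡ q
    arcs    : ∀ {x} → x ∈ members → T ∋ w ⇒ x

  member≢centre : ∀ {x} → x ∈ members → x ≢ w
  member≢centre x∈ refl = irrefl T w (arcs x∈)

module _ {n : ℕ} (T : Tournament n) where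

  fan-at : ∀ {U w} q → Unique U → q ≤ outDegree T U w → Σ (OutFan T w q) λ F → OutFan.members F ⊆ U
  fan-at {U} {w} q uU q≤out with sublist-of-length q (Unique.filter⁺ (arc? T w) uU) q≤out
  fan-at {U} {w} q uU q≤out | N , uN , |N| , N⊆ =
    record { members = N ; unique = uN ; size = |N| ; arcs = proj₂ ∘ out ∘ N⊆ } , proj₁ ∘ out ∘ N⊆
    where
    out : ∀ {x} → x ∈ filter (arc? T w) U → x ∈ U × T ∋ w ⇒ x
    out = ∈-filter⁻ (arc? T w) {xs = U}

  dominating-fan : ∀ {U} q → Unique U → 2 * q < length U →
                   ∃ λ w → w ∈ U × Σ (OutFan T w q) λ F → OutFan.members F ⊆ U
  dominating-fan q uU big with dominating-vertex T q uU big
  ... | w , w∈ , q≤out = w , w∈ , fan-at q uU q≤out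

  common-out-fan : ∀ {G} k → Unique G → 2 * suc (2 * k) < length G →
    ∃ λ s₀ → ∃ λ s₁ → s₀ ∈ G × s₁ ∈ G × T ∋ s₀ ⇒ s₁ ×
      Σ (OutFan T s₁ k) λ F → ∀ {x} → x ∈ OutFan.members F → x ∈ G × T ∋ s₀ ⇒ x
  common-out-fan k uG big with dominating-fan (suc (2 * k)) uG big
  ... | s₀ , s₀∈ , F₁ , F₁⊆G with dominating-fan k (OutFan.unique F₁) (≤-reflexive (sym (OutFan.size F₁)))
  ... | s₁ , s₁∈F₁ , F₂ , F₂⊆F₁ =
    s₀ , s₁ , s₀∈ , F₁⊆G s₁∈F₁ , OutFan.arcs F₁ s₁∈F₁ , F₂ , λ x∈ → F₁⊆G (F₂⊆F₁ x∈) , OutFan.arcs F₁ (F₂⊆F₁ x∈)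

module _ {n : ℕ} where

  open import Data.List.Membership.DecPropositional (_≟_ {n}) using (_∈?_; _∉?_)

  -- Of t + |tips| neighbours inside Lf, at most the |tips| tips are hit by f.
  outDegree⇒NbrOutsideAtLeast :
    ∀ {A : Set} {x : ℚ} {t : ℕ} (T : Tournament n) σ v (f : A → Fin n) {Lf tips : List (Fin n)} →
    Unique Lf → (∀ a → f a ∈ tips ⊎ f a ∉ Lf) → x ≤ℚ ℕtoℚ t →
    t + length tips ≤ outDegree (orient T σ) Lf v → NbrOutsideAtLeast T σ v f x
  outDegree⇒NbrOutsideAtLeast {t = t} T σ v f {Lf} {tips} uLf f∈ x≤t big =
    length W , ℚ.≤-trans x≤t (ℕtoℚ-mono t≤|W|) , lookup W , lookup-injective uW ,
    λ i → orient⇒Nbr T σ (proj₂ (inN (proj₁ (inW (∈-lookup i))))) , missed (∈-lookup i)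
    where
    N : List (Fin n)
    N = filter (arc? (orient T σ) v) Lf
    W : List (Fin n)
    W = filter (_∉? tips) N
    inN : ∀ {w} → w ∈ N → w ∈ Lf × orient T σ ∋ v ⇒ w
    inN = ∈-filter⁻ (arc? (orient T σ) v) {xs = Lf}
    inW : ∀ {w} → w ∈ W → w ∈ N × w ∉ tips
    inW = ∈-filter⁻ (_∉? tips) {xs = N}
    uW : Unique W
    uW = Unique.filter⁺ (_∉? tips) (Unique.filter⁺ (arc? (orient T σ) v) uLf)
    missed : ∀ {w} → w ∈ W → ∀ a → f a ≢ w
    missed w∈ a refl = [ proj₂ (inW w∈) , (λ w∉Lf → w∉Lf (proj₁ (inN (proj₁ (inW w∈))))) ]′ (f∈ a)
    tipsInN≤ : length (filter (_∈? tips) N) ≤ length tips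
    tipsInN≤ = Unique-⊆⇒length≤ (Unique.filter⁺ (_∈? tips) (Unique.filter⁺ (arc? (orient T σ) v) uLf))
                                (proj₂ ∘ ∈-filter⁻ (_∈? tips) {xs = N})
    t≤|W| : t ≤ length W
    t≤|W| = +-cancelʳ-≤ (length tips) t (length W) (begin
      t + length tips                          ≤⟨ big ⟩
      length N                                 ≡⟨ sym (length-filter-∁ (_∈? tips) N) ⟩
      length (filter (_∈? tips) N) + length W  ≤⟨ +-monoˡ-≤ (length W) tipsInN≤ ⟩
      length tips + length W                   ≡⟨ +-comm (length tips) (length W) ⟩
      length W + length tips                   ∎)
      where open ≤-Reasoning

module _ {n m : ℕ} (T : Fin m → Tournament n) (Lf : List (Fin n)) (s : ℕ) where

  Good : List (Fin m) → Fin n → Set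
  Good Ds v = All (λ d → s ≤ outDegree (T d) Lf v × s ≤ outDegree (converse (T d)) Lf v) Ds

  good? : ∀ Ds → Decidable (Good Ds)
  good? Ds v = all? (λ d → (s ≤? outDegree (T d) Lf v) ×-dec (s ≤? outDegree (converse (T d)) Lf v)) Ds

  Good⇒outDegree : ∀ {Ds v d} → Good Ds v → d ∈ Ds → ∀ σ → s ≤ outDegree (orient (T d) σ) Lf v
  Good⇒outDegree good d∈ true  = proj₁ (All.lookup good d∈)
  Good⇒outDegree good d∈ false = proj₂ (All.lookup good d∈)

  few-not-good : Unique Lf → ∀ Ds → length (filter (∁? (good? Ds)) Lf) ≤ length Ds * (4 * s)
  few-not-good uLf []       =
    ≤-reflexive (cong length (filter-none (∁? (good? [])) (All.universal (λ _ ¬good → ¬good All.[]) Lf)))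
  few-not-good uLf (d ∷ Ds) = begin
    length (filter (∁? (good? (d ∷ Ds))) Lf)
      ≤⟨ length-filter-⊎ (∁? (good? (d ∷ Ds))) lowOut? (λ v → lowIn? v ⊎-dec ∁? (good? Ds) v) uLf cover ⟩
    length (filter lowOut? Lf) + length (filter (λ v → lowIn? v ⊎-dec ∁? (good? Ds) v) Lf)
      ≤⟨ +-monoʳ-≤ (length (filter lowOut? Lf)) (length-filter-⊎ _ lowIn? (∁? (good? Ds)) uLf (λ _ → id)) ⟩
    length (filter lowOut? Lf) + (length (filter lowIn? Lf) + length (filter (∁? (good? Ds)) Lf))
      ≤⟨ +-mono-≤ (few-low-outDegree (T d) uLf s)
                  (+-mono-≤ (few-low-outDegree (converse (T d)) uLf s) (few-not-good uLf Ds)) ⟩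
    2 * s + (2 * s + length Ds * (4 * s))
      ≡⟨ regroup s (length Ds) ⟩
    length (d ∷ Ds) * (4 * s) ∎
    where
    open ≤-Reasoning
    lowOut? : Decidable (λ v → outDegree (T d) Lf v < s)
    lowOut? v = outDegree (T d) Lf v <? s
    lowIn? : Decidable (λ v → outDegree (converse (T d)) Lf v < s)
    lowIn? v = outDegree (converse (T d)) Lf v <? s
    cover : ∀ {v} → v ∈ Lf → ¬ Good (d ∷ Ds) v →
            outDegree (T d) Lf v < s ⊎ (outDegree (converse (T d)) Lf v < s ⊎ ¬ Good Ds v)
    cover {v} _ ¬good with lowOut? v | lowIn? v | good? Ds v
    ... | yes lo | _      | _     = inj₁ lo
    ... | no _   | yes li | _     = inj₂ (inj₁ li)
    ... | no _   | no _   | no ¬g = inj₂ (inj₂ ¬g)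
    ... | no ¬lo | no ¬li | yes g = contradiction ((≮⇒≥ ¬lo , ≮⇒≥ ¬li) All.∷ g) ¬good
    regroup : ∀ s k → 2 * s + (2 * s + k * (4 * s)) ≡ suc k * (4 * s)
    regroup = solve-∀

  good-count : Unique Lf → ∀ Ds {N} → Unique N → N ⊆ Lf →
               length N ≤ length (filter (good? Ds) N) + length Ds * (4 * s)
  good-count uLf Ds {N} uN N⊆ = begin
    length N                                                          ≡⟨ sym (length-filter-∁ (good? Ds) N) ⟩
    length (filter (good? Ds) N) + length (filter (∁? (good? Ds)) N)  ≤⟨ +-monoʳ-≤ _ (≤-trans bad⊆ (few-not-good uLf Ds)) ⟩
    length (filter (good? Ds) N) + length Ds * (4 * s)                ∎
    where
    open ≤-Reasoning
    bad⊆ : length (filter (∁? (good? Ds)) N) ≤ length (filter (∁? (good? Ds)) Lf)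
    bad⊆ = Unique-⊆⇒length≤ (Unique.filter⁺ _ uN) λ v∈ →
      let v∈N , ¬g = ∈-filter⁻ (∁? (good? Ds)) {xs = N} v∈ in ∈-filter⁺ (∁? (good? Ds)) (N⊆ v∈N) ¬g

-- Rainbow paths

module _ {n m : ℕ} (T : Fin m → Tournament n) where

  -- vs[0] = u → vs[1] → ⋯ → vs[J] = y, the arc vs[i] → vs[i+1] lying in T cs[i].
  data RainbowPath : ∀ {J} → Fin n → Fin n → Vec (Fin n) (suc J) → Vec (Fin m) J → Set where
    [_]  : ∀ v → RainbowPath v v (v ∷ []) []
    step : ∀ {J u v y} {vs : Vec (Fin n) (suc J)} {cs : Vec (Fin m) J} c →
           T c ∋ u ⇒ v → u ∉ᵥ vs → c ∉ᵥ cs → RainbowPath v y vs cs → RainbowPath u y (u ∷ vs) (c ∷ cs)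

  path-head : ∀ {J u y vs cs} → RainbowPath {J} u y vs cs → u ∈ᵥ vs
  path-head [ _ ]            = here refl
  path-head (step _ _ _ _ _) = here refl

  path-last : ∀ {J u y vs cs} → RainbowPath {J} u y vs cs → y ∈ᵥ vs
  path-last [ _ ]            = here refl
  path-last (step _ _ _ _ p) = there (path-last p)

  path-arc : ∀ {J u y vs cs} → RainbowPath {J} u y vs cs →
             ∀ i → T (Vec.lookup cs i) ∋ Vec.lookup vs (inject₁ i) ⇒ Vec.lookup vs (suc i)
  path-arc (step c u⇒v _ _ [ _ ])            zero    = u⇒v
  path-arc (step c u⇒v _ _ (step _ _ _ _ _)) zero    = u⇒v
  path-arc (step _ _   _ _ p)                (suc i) = path-arc p i

  path-vertices-injective : ∀ {J u y vs cs} → RainbowPath {J} u y vs cs → Injective _≡_ _≡_ (Vec.lookup vs)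
  path-vertices-injective [ _ ]             = lookup-∷-injective (λ ()) lookup-[]-injective
  path-vertices-injective (step _ _ u∉ _ p) = lookup-∷-injective u∉ (path-vertices-injective p)

  path-colours-injective : ∀ {J u y vs cs} → RainbowPath {J} u y vs cs → Injective _≡_ _≡_ (Vec.lookup cs)
  path-colours-injective [ _ ]             = lookup-[]-injective
  path-colours-injective (step _ _ _ c∉ p) = lookup-∷-injective c∉ (path-colours-injective p)

  path-snoc : ∀ {J u y w c vs cs} → RainbowPath {J} u y vs cs → T c ∋ y ⇒ w → w ∉ᵥ vs → c ∉ᵥ cs →
              RainbowPath u w (vs ∷ʳ w) (cs ∷ʳ c)
  path-snoc [ v ] y⇒w w∉ _ = step _ y⇒w (∉ᵥ-∷ (λ v≡w → w∉ (here (sym v≡w))) λ ()) (λ ()) [ _ ]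
  path-snoc (step c′ u⇒v u∉ c′∉ p) y⇒w w∉ c∉ =
    step c′ u⇒v (∉ᵥ-∷ʳ u∉ (λ u≡w → w∉ (here (sym u≡w)))) (∉ᵥ-∷ʳ c′∉ (λ c′≡c → c∉ (here (sym c′≡c))))
         (path-snoc p y⇒w (w∉ ∘ there) (c∉ ∘ there))

  record Insertion {J} (u y w : Fin n) (a b : Fin m) (vs : Vec (Fin n) (suc J)) (cs : Vec (Fin m) J) : Set where
    field
      {vertices} : Vec (Fin n) (suc (suc J))
      {colours}  : Vec (Fin m) (suc J)
      path       : RainbowPath u y vertices colours
      vertex-new : ∀ {x} → x ∈ᵥ vertices → x ≡ w ⊎ x ∈ᵥ vs
      colour-new : ∀ {c} → c ∈ᵥ colours → c ≡ a ⊎ c ≡ b ⊎ c ∈ᵥ cs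

  -- Along the walk the current vertex beats w in colours a and b. As w beats y in colour a,
  -- w beats some next vertex v in colour a or b, and is spliced in just before v.
  path-insert : ∀ {J u y w a b vs cs} → RainbowPath {J} u y vs cs →
                w ∉ᵥ vs → a ≢ b → a ∉ᵥ cs → b ∉ᵥ cs →
                T a ∋ u ⇒ w → T b ∋ u ⇒ w → T a ∋ w ⇒ y → Insertion u y w a b vs cs
  path-insert {a = a} [ u ] _ _ _ _ u⇒w _ w⇒u = contradiction w⇒u (asym (T a) u _ u⇒w)
  path-insert {u = u} {y = y} {w = w} {a = a} {b = b} (step {v = v} {vs = vs} {cs = cs} c u⇒v u∉ c∉ p)
              w∉ a≢b a∉ b∉ u⇒ᵃw u⇒ᵇw w⇒ᵃy
    with arc? (T b) w v | arc? (T a) w v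
  ... | yes w⇒ᵇv | _ = record
    { path       = step a u⇒ᵃw (∉ᵥ-∷ u≢w u∉) (∉ᵥ-∷ a≢b (a∉ ∘ there)) (step b w⇒ᵇv (w∉ ∘ there) (b∉ ∘ there) p)
    ; vertex-new = ∈ᵥ-spliced
    ; colour-new = λ { (here refl) → inj₁ refl ; (there (here refl)) → inj₂ (inj₁ refl)
                     ; (there (there c∈)) → inj₂ (inj₂ (there c∈)) }
    }
    where
    u≢w : u ≢ w
    u≢w u≡w = w∉ (here (sym u≡w))
  ... | no _ | yes w⇒ᵃv = record
    { path       = step b u⇒ᵇw (∉ᵥ-∷ u≢w u∉) (∉ᵥ-∷ (a≢b ∘ sym) (b∉ ∘ there)) (step a w⇒ᵃv (w∉ ∘ there) (a∉ ∘ there) p)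
    ; vertex-new = ∈ᵥ-spliced
    ; colour-new = λ { (here refl) → inj₂ (inj₁ refl) ; (there (here refl)) → inj₁ refl
                     ; (there (there c∈)) → inj₂ (inj₂ (there c∈)) }
    }
    where
    u≢w : u ≢ w
    u≢w u≡w = w∉ (here (sym u≡w))
  ... | no ¬w⇒ᵇv | no ¬w⇒ᵃv = record
    { path       = step c u⇒v u∉rest c∉rest (path rest)
    ; vertex-new = λ { (here eq) → inj₂ (here eq) ; (there x∈) → map₂ there (vertex-new rest x∈) }
    ; colour-new = λ { (here eq) → inj₂ (inj₂ (here eq)) ; (there c∈) → map₂ (map₂ there) (colour-new rest c∈) }
    }
    where
    open Insertion
    w≢v : w ≢ v
    w≢v w≡v = w∉ (there (subst (_∈ᵥ vs) (sym w≡v) (path-head p)))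
    rest : Insertion v y w a b vs cs
    rest = path-insert p (w∉ ∘ there) a≢b (a∉ ∘ there) (b∉ ∘ there)
                       (¬⇒-flip (T a) w≢v ¬w⇒ᵃv) (¬⇒-flip (T b) w≢v ¬w⇒ᵇv) w⇒ᵃy
    u∉rest : u ∉ᵥ vertices rest
    u∉rest u∈ = [ (λ u≡w → w∉ (here (sym u≡w))) , u∉ ]′ (vertex-new rest u∈)
    c∉rest : c ∉ᵥ colours rest
    c∉rest c∈ = [ (λ c≡a → a∉ (here (sym c≡a))) , [ (λ c≡b → b∉ (here (sym c≡b))) , c∉ ]′ ]′ (colour-new rest c∈)

  ¬insertable : ∀ {a b u w y} → u ≢ w → w ≢ y → ¬ (T a ∋ u ⇒ w × T b ∋ u ⇒ w × T a ∋ w ⇒ y) →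
                T a ∋ w ⇒ u ⊎ T b ∋ w ⇒ u ⊎ T a ∋ y ⇒ w
  ¬insertable {a} {b} {u} {w} {y} u≢w w≢y ¬ins with arc? (T a) u w | arc? (T b) u w | arc? (T a) w y
  ... | no ¬α | _     | _     = inj₁ (¬⇒-flip (T a) u≢w ¬α)
  ... | yes _ | no ¬β | _     = inj₂ (inj₁ (¬⇒-flip (T b) u≢w ¬β))
  ... | yes _ | yes _ | no ¬γ = inj₂ (inj₂ (¬⇒-flip (T a) w≢y ¬γ))
  ... | yes α | yes β | yes γ = contradiction (α , β , γ) ¬ins

-- Growing the path

module PathGrowth {n m : ℕ} (T : Fin m → Tournament n) (cS cE : Fin m) (Dl : List (Fin m)) (q : ℕ) where

  Forbidden : List (Fin m)
  Forbidden = cS ∷ cE ∷ Dl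

  record State (j : ℕ) : Set where
    field
      {source target} : Fin n
      {vertices}      : Vec (Fin n) (suc j)
      {colours}       : Vec (Fin m) j
      path            : RainbowPath T source target vertices colours
      colours-allowed : ∀ {c} → c ∈ᵥ colours → c ∉ Forbidden
      inFan           : OutFan (converse (T cS)) source q
      outFan          : OutFan (T cE) target q
      inFan-off       : ∀ {x} → x ∈ OutFan.members inFan → x ∉ᵥ vertices
      outFan-off      : ∀ {x} → x ∈ OutFan.members outFan → x ∉ᵥ vertices

  open OutFan using (members; member≢centre)

  module Moves {j : ℕ} (st : State j) where

    open State st

    used : List (Fin n)
    used = Vec.toList vertices ++ members inFan ++ members outFan

    length-used : length used ≡ suc j + (q + q)
    length-used = begin
      length used                                                       ≡⟨ length-++ (Vec.toList vertices) ⟩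
      length (Vec.toList vertices) + length (members inFan ++ members outFan)
        ≡⟨ cong₂ _+_ (length-toList vertices) (length-++ (members inFan)) ⟩
      suc j + (length (members inFan) + length (members outFan))
        ≡⟨ cong (suc j +_) (cong₂ _+_ (OutFan.size inFan) (OutFan.size outFan)) ⟩
      suc j + (q + q)                                                   ∎
      where open ≡-Reasoning

    pool : List (Fin n)
    pool = avoiding used

    Free : Fin n → Set
    Free w = w ∉ᵥ vertices × w ∉ members inFan × w ∉ members outFan

    pool-free : ∀ {w} → w ∈ pool → Free w
    pool-free {w} w∈ = (λ w∈vs → w∉ (∈-++⁺ˡ (∈-toList⁺ w∈vs)))
                 , (λ w∈in → w∉ (∈-++⁺ʳ (Vec.toList vertices) (∈-++⁺ˡ w∈in)))
                 , (λ w∈out → w∉ (∈-++⁺ʳ (Vec.toList vertices) (∈-++⁺ʳ (members inFan) w∈out)))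
      where
      w∉ : w ∉ used
      w∉ = ∈-avoiding⁻ w∈

    module _ {P : Pred (Fin n) 0ℓ} (P? : Decidable P) where

      pool-filter-unique : Unique (filter P? pool)
      pool-filter-unique = Unique.filter⁺ P? (avoiding-unique used)

      pool-filter-free : ∀ {w} → w ∈ filter P? pool → Free w
      pool-filter-free = pool-free ∘ proj₁ ∘ ∈-filter⁻ P? {xs = pool}

      pool-filter-property : ∀ {w} → w ∈ filter P? pool → P w
      pool-filter-property = proj₂ ∘ ∈-filter⁻ P? {xs = pool}

    into : ∀ c → Decidable (λ w → T c ∋ w ⇒ source)
    into c w = arc? (T c) w source

    out-of : ∀ c → Decidable (λ w → T c ∋ target ⇒ w)
    out-of c = arc? (T c) target

    prepend : ∀ {c} → c ∉ Forbidden → c ∉ᵥ colours → 2 * q < length (filter (into c) pool) → State (suc j)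
    prepend {c} c∉F c∉ big = from-fan (dominating-fan (converse (T cS)) q (pool-filter-unique (into c)) big)
      where
      from-fan : (∃ λ w → w ∈ filter (into c) pool ×
                   Σ (OutFan (converse (T cS)) w q) λ F → members F ⊆ filter (into c) pool) → State (suc j)
      from-fan (w , w∈K , fan , fan⊆K) = record
        { path            = step c (pool-filter-property (into c) w∈K) (proj₁ (pool-filter-free (into c) w∈K)) c∉ path
        ; colours-allowed = λ { (here refl) → c∉F ; (there c∈) → colours-allowed c∈ }
        ; inFan           = fan
        ; outFan          = outFan
        ; inFan-off       = λ x∈ → ∉ᵥ-∷ (member≢centre fan x∈) (proj₁ (pool-filter-free (into c) (fan⊆K x∈)))
        ; outFan-off      = λ x∈ → ∉ᵥ-∷ (λ { refl → proj₂ (proj₂ (pool-filter-free (into c) w∈K)) x∈ })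
                                         (outFan-off x∈)
        }

    append : ∀ {c} → c ∉ Forbidden → c ∉ᵥ colours → 2 * q < length (filter (out-of c) pool) → State (suc j)
    append {c} c∉F c∉ big = from-fan (dominating-fan (T cE) q (pool-filter-unique (out-of c)) big)
      where
      from-fan : (∃ λ w → w ∈ filter (out-of c) pool ×
                   Σ (OutFan (T cE) w q) λ F → members F ⊆ filter (out-of c) pool) → State (suc j)
      from-fan (w , w∈K , fan , fan⊆K) = record
        { path            = path-snoc T path (pool-filter-property (out-of c) w∈K)
                                      (proj₁ (pool-filter-free (out-of c) w∈K)) c∉
        ; colours-allowed = λ c′∈ → [ colours-allowed , (λ { refl → c∉F }) ]′ (∈ᵥ-∷ʳ⁻ colours c′∈)
        ; inFan           = inFan
        ; outFan          = fan
        ; inFan-off       = λ x∈ → ∉ᵥ-∷ʳ (inFan-off x∈) (λ { refl → proj₁ (proj₂ (pool-filter-free (out-of c) w∈K)) x∈ })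
        ; outFan-off      = λ x∈ → ∉ᵥ-∷ʳ (proj₁ (pool-filter-free (out-of c) (fan⊆K x∈))) (member≢centre fan x∈)
        }

    insert : ∀ {a b w} → a ≢ b → a ∉ Forbidden → b ∉ Forbidden → a ∉ᵥ colours → b ∉ᵥ colours → w ∈ pool →
             T a ∋ source ⇒ w → T b ∋ source ⇒ w → T a ∋ w ⇒ target → State (suc j)
    insert {a} {b} {w} a≢b a∉F b∉F a∉ b∉ w∈ α β γ = record
      { path            = Insertion.path ins
      ; colours-allowed = λ c∈ → [ (λ { refl → a∉F }) , [ (λ { refl → b∉F }) , colours-allowed ]′ ]′
                                   (Insertion.colour-new ins c∈)
      ; inFan           = inFan
      ; outFan          = outFan
      ; inFan-off       = λ x∈ x∈′ → [ (λ { refl → proj₁ (proj₂ (pool-free w∈)) x∈ }) , inFan-off x∈ ]′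
                                        (Insertion.vertex-new ins x∈′)
      ; outFan-off      = λ x∈ x∈′ → [ (λ { refl → proj₂ (proj₂ (pool-free w∈)) x∈ }) , outFan-off x∈ ]′
                                        (Insertion.vertex-new ins x∈′)
      }
      where
      ins : Insertion T source target w a b vertices colours
      ins = path-insert T path (proj₁ (pool-free w∈)) a≢b a∉ b∉ α β γ

    extend-with : ∀ {a b} → a ≢ b → a ∉ Forbidden → b ∉ Forbidden → a ∉ᵥ colours → b ∉ᵥ colours →
                  3 * (2 * q) < length pool → State (suc j)
    extend-with {a} {b} a≢b a∉F b∉F a∉ b∉ big =
      by-insertion (any? (λ w → arc? (T a) source w ×-dec arc? (T b) source w ×-dec arc? (T a) w target) pool)
      where
      by-side : 2 * q < length (filter (into a) pool) ⊎ 2 * q < length (filter (into b) pool)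
                  ⊎ 2 * q < length (filter (out-of a) pool) → State (suc j)
      by-side (inj₁ many)        = prepend a∉F a∉ many
      by-side (inj₂ (inj₁ many)) = prepend b∉F b∉ many
      by-side (inj₂ (inj₂ many)) = append a∉F a∉ many
      by-insertion : Dec (Any (λ w → T a ∋ source ⇒ w × T b ∋ source ⇒ w × T a ∋ w ⇒ target) pool) →
                     State (suc j)
      by-insertion (yes some) =
        let w , w∈ , α , β , γ = find some in insert a≢b a∉F b∉F a∉ b∉ w∈ α β γ
      by-insertion (no none) =
        by-side (filter-pigeonhole₃ (into a) (into b) (out-of a) (2 * q) (avoiding-unique used) escape big)
        where
        escape : ∀ {w} → w ∈ pool → T a ∋ w ⇒ source ⊎ T b ∋ w ⇒ source ⊎ T a ∋ target ⇒ w
        escape w∈ = ¬insertable T (λ { refl → proj₁ (pool-free w∈) (path-head T path) })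
                                  (λ { refl → proj₁ (pool-free w∈) (path-last T path) })
                                  (All.lookup (¬Any⇒All¬ pool none) w∈)

  extend : ∀ {j} → State j → j + 8 * q + 2 ≤ n → length Dl + j + 4 ≤ m → State (suc j)
  extend {j} st n-big m-big = extend′ (fresh-pair X X-small)
    where
    open State st
    open Moves st
    X : List (Fin m)
    X = Forbidden ++ Vec.toList colours
    X-small : 2 + length X ≤ m
    X-small = ≤-trans (≤-reflexive (begin
      2 + length X                               ≡⟨ cong (2 +_) (length-++ Forbidden) ⟩
      2 + (2 + length Dl + length (Vec.toList colours)) ≡⟨ cong (λ k → 2 + (2 + length Dl + k)) (length-toList colours) ⟩
      2 + (2 + length Dl + j)                    ≡⟨ regroup (length Dl) j ⟩
      length Dl + j + 4                          ∎)) m-big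
      where
      open ≡-Reasoning
      regroup : ∀ d j → 2 + (2 + d + j) ≡ d + j + 4
      regroup = solve-∀
    pool-big : 3 * (2 * q) < length pool
    pool-big = +-cancelʳ-≤ (length used) _ _ (begin
      suc (3 * (2 * q)) + length used        ≡⟨ cong (suc (3 * (2 * q)) +_) length-used ⟩
      suc (3 * (2 * q)) + (suc j + (q + q))  ≡⟨ regroup q j ⟩
      j + 8 * q + 2                          ≤⟨ n-big ⟩
      n                                      ≤⟨ length-avoiding used ⟩
      length pool + length used              ∎)
      where
      open ≤-Reasoning
      regroup : ∀ q j → suc (3 * (2 * q)) + (suc j + (q + q)) ≡ j + 8 * q + 2
      regroup = solve-∀
    fresh : ∀ {c} → c ∉ X → c ∉ Forbidden × c ∉ᵥ colours
    fresh c∉ = c∉ ∘ ∈-++⁺ˡ , c∉ ∘ ∈-++⁺ʳ Forbidden ∘ ∈-toList⁺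
    extend′ : (∃ λ a → ∃ λ b → a ≢ b × a ∉ X × b ∉ X) → State (suc j)
    extend′ (a , b , a≢b , a∉X , b∉X) =
      extend-with a≢b (proj₁ (fresh a∉X)) (proj₁ (fresh b∉X)) (proj₂ (fresh a∉X)) (proj₂ (fresh b∉X)) pool-big

  init : 4 * q < n → State 0
  init big = from-vertex (length-filter<⇒∃∁ low? (allFin n) few-low)
    where
    low? : Decidable (λ v → outDegree (converse (T cS)) (allFin n) v < q ⊎ outDegree (T cE) (allFin n) v < q)
    low? v = (outDegree (converse (T cS)) (allFin n) v <? q) ⊎-dec (outDegree (T cE) (allFin n) v <? q)
    few-low : length (filter low? (allFin n)) < length (allFin n)
    few-low = begin-strict
      length (filter low? (allFin n))
        ≤⟨ length-filter-⊎ low? _ _ (Unique.allFin⁺ n) (λ _ → id) ⟩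
      length (filter (λ v → outDegree (converse (T cS)) (allFin n) v <? q) (allFin n))
        + length (filter (λ v → outDegree (T cE) (allFin n) v <? q) (allFin n))
        ≤⟨ +-mono-≤ (few-low-outDegree (converse (T cS)) (Unique.allFin⁺ n) q)
                    (few-low-outDegree (T cE) (Unique.allFin⁺ n) q) ⟩
      2 * q + 2 * q  ≡⟨ regroup q ⟩
      4 * q          <⟨ big ⟩
      n              ≡⟨ sym (length-tabulate id) ⟩
      length (allFin n) ∎
      where
      open ≤-Reasoning
      regroup : ∀ q → 2 * q + 2 * q ≡ 4 * q
      regroup = solve-∀
    from-vertex : (∃ λ z → z ∈ allFin n × ¬ (outDegree (converse (T cS)) (allFin n) z < q ⊎ outDegree (T cE) (allFin n) z < q)) →
                  State 0
    from-vertex (z , _ , ¬low) = record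
      { path            = [ z ]
      ; colours-allowed = λ ()
      ; inFan           = inF
      ; outFan          = outF
      ; inFan-off       = λ x∈ → ∉ᵥ-∷ (member≢centre inF x∈) (λ ())
      ; outFan-off      = λ x∈ → ∉ᵥ-∷ (member≢centre outF x∈) (λ ())
      }
      where
      inF : OutFan (converse (T cS)) z q
      inF = proj₁ (fan-at (converse (T cS)) q (Unique.allFin⁺ n) (≮⇒≥ (¬low ∘ inj₁)))
      outF : OutFan (T cE) z q
      outF = proj₁ (fan-at (T cE) q (Unique.allFin⁺ n) (≮⇒≥ (¬low ∘ inj₂)))

  grow : ∀ J → J + 8 * q + 2 ≤ n → length Dl + J + 4 ≤ m → State J
  grow zero    n-big _     = init (<-≤-trans (≤-<-trans (*-monoˡ-≤ q (m≤m+n 4 4)) (m<m+n (8 * q) (s≤s z≤n))) n-big)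
  grow (suc J) n-big m-big = extend (grow J n-big′ m-big′) n-big′ m-big′
    where
    n-big′ : J + 8 * q + 2 ≤ n
    n-big′ = ≤-trans (+-monoˡ-≤ 2 (+-monoˡ-≤ (8 * q) (n≤1+n J))) n-big
    m-big′ : length Dl + J + 4 ≤ m
    m-big′ = ≤-trans (+-monoˡ-≤ 4 (+-monoʳ-≤ (length Dl) (n≤1+n J))) m-big

-- Assembling a broom from its copies of P

module _ {L s₁ s₂ : ℕ} where

  pos-inject₁ : ∀ (a : Fin s₁) (b : Fin s₂) j → pos {suc L} a b (suc (inject₁ j)) ≡ mid j
  pos-inject₁ a b j with toℕ (inject₁ j) <? L
  ... | yes j<L = cong mid (toℕ-injective (trans (toℕ-fromℕ< j<L) (toℕ-inject₁ j)))
  ... | no j≮L  = contradiction (subst (_< L) (sym (toℕ-inject₁ j)) (toℕ<n j)) j≮L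

  pos-fromℕ : ∀ (a : Fin s₁) (b : Fin s₂) → pos {suc L} a b (suc (fromℕ L)) ≡ end b
  pos-fromℕ a b with toℕ (fromℕ L) <? L
  ... | yes L<L = contradiction (subst (_< L) (toℕ-fromℕ L) L<L) (<-irrefl refl)
  ... | no _    = refl

module _ {n m : ℕ} (T : Fin m → Tournament n) (D : Subset m) (x : ℚ) {L s₁ s₂ : ℕ}
         (S : Fin (suc s₁) → Fin n) (mids : Vec (Fin n) L) (E : Fin (suc s₂) → Fin n)
         (C : Vec (Fin m) (suc L)) where

  broomVertex : BVert (suc L) (suc s₁) (suc s₂) → Fin n
  broomVertex (start a) = S a
  broomVertex (mid i)   = Vec.lookup mids i
  broomVertex (end b)   = E b

  -- The colour of the arc leaving a vertex towards the end-tips; end-tips get an arbitrary one.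
  broomColour : BVert (suc L) (suc s₁) (suc s₂) → Fin m
  broomColour (start _) = Vec.lookup C zero
  broomColour (mid i)   = Vec.lookup C (suc i)
  broomColour (end _)   = Vec.lookup C zero

  copy : Fin (suc s₁) → Fin (suc s₂) → Vec (Fin n) (suc (suc L))
  copy a b = S a ∷ (mids ∷ʳ E b)

  broomVertex-pos : ∀ a b k → broomVertex (pos a b k) ≡ Vec.lookup (copy a b) k
  broomVertex-pos a b zero = refl
  broomVertex-pos a b (suc k) with view k
  ... | ‵fromℕ     = trans (cong broomVertex (pos-fromℕ a b)) (sym (lookup-∷ʳ-fromℕ mids (E b)))
  ... | ‵inj₁ {i = j} _ = trans (cong broomVertex (pos-inject₁ a b j)) (sym (lookup-∷ʳ-inject₁ mids (E b) j))

  broomColour-arc : ∀ a b i → broomColour (arcFrom a b i) ≡ Vec.lookup C i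
  broomColour-arc a b zero    = refl
  broomColour-arc a b (suc j) = cong broomColour (pos-inject₁ a b j)

  forward-broom : Injective _≡_ _≡_ S → Injective _≡_ _≡_ E →
    (∀ a b → RainbowPath T (S a) (E b) (copy a b) C) → (∀ i → Vec.lookup C i ∉ₛ D) →
    (∀ a d → d ∈ₛ D → ∀ σ → NbrOutsideAtLeast (T d) σ (S a) broomVertex x) →
    (∀ b d → d ∈ₛ D → ∀ σ → NbrOutsideAtLeast (T d) σ (E b) broomVertex x) →
    GoodBroom n m T (suc L) (forward (suc L)) (suc s₁) (suc s₂) D x
  forward-broom S-inj E-inj paths avoid start-tips end-tips = record
    { f        = broomVertex
    ; f-inj    = vertex-injective
    ; φ        = λ u _ → broomColour u
    ; arcs     = arcs
    ; avoidD   = λ a b i → subst (_∉ₛ D) (sym (broomColour-arc a b i)) (avoid i)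
    ; startCol = Vec.lookup C zero , λ a b i i≡0 → trans (broomColour-arc a b i) (cong (Vec.lookup C) (toℕ-injective i≡0))
    ; endCol   = Vec.lookup C (fromℕ L) , λ a b i i≡L → trans (broomColour-arc a b i)
                   (cong (Vec.lookup C) (toℕ-injective (trans (suc-injective i≡L) (sym (toℕ-fromℕ L)))))
    ; rainbow  = λ a b eq → path-colours-injective T (paths a b)
                   (trans (sym (broomColour-arc a b _)) (trans eq (broomColour-arc a b _)))
    ; tips     = λ { _ (start-tip a) → start-tips a ; _ (end-tip b) → end-tips b }
    }
    where
    arcs : ∀ a b i → T (broomColour (arcFrom a b i)) ∋ broomVertex (arcFrom a b i) ⇒ broomVertex (arcTo a b i)
    arcs a b i rewrite broomColour-arc a b i | broomVertex-pos a b (inject₁ i) | broomVertex-pos a b (suc i) =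
      path-arc T (paths a b) i

    InCopy : Fin (suc s₁) → Fin (suc s₂) → BVert (suc L) (suc s₁) (suc s₂) → Set
    InCopy a b u = ∃ λ k → pos a b k ≡ u

    copy-injective : ∀ {a b u v} → InCopy a b u → InCopy a b v → broomVertex u ≡ broomVertex v → u ≡ v
    copy-injective {a} {b} (k , refl) (k′ , refl) eq = cong (pos a b) (path-vertices-injective T (paths a b) {k} {k′}
      (trans (sym (broomVertex-pos a b k)) (trans eq (broomVertex-pos a b k′))))

    start∈ : ∀ a b → InCopy a b (start a)
    start∈ a b = zero , refl
    mid∈ : ∀ a b j → InCopy a b (mid j)
    mid∈ a b j = suc (inject₁ j) , pos-inject₁ a b j
    end∈ : ∀ a b → InCopy a b (end b)
    end∈ a b = suc (fromℕ L) , pos-fromℕ a b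

    -- Two vertices that are not both start-tips or both end-tips lie on a common copy.
    vertex-injective : Injective _≡_ _≡_ broomVertex
    vertex-injective {start a} {start a′} eq = cong start (S-inj eq)
    vertex-injective {end b}   {end b′}   eq = cong end (E-inj eq)
    vertex-injective {start a} {mid j}       = copy-injective (start∈ a zero) (mid∈ a zero j)
    vertex-injective {start a} {end b}       = copy-injective (start∈ a b) (end∈ a b)
    vertex-injective {mid i}   {start a}     = copy-injective (mid∈ a zero i) (start∈ a zero)
    vertex-injective {mid i}   {mid j}       = copy-injective (mid∈ zero zero i) (mid∈ zero zero j)
    vertex-injective {mid i}   {end b}       = copy-injective (mid∈ zero b i) (end∈ zero b)
    vertex-injective {end b}   {start a}     = copy-injective (end∈ a b) (start∈ a b)
    vertex-injective {end b}   {mid j}       = copy-injective (end∈ zero b) (mid∈ zero b j)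

converse-broom : ∀ {n m ℓ s₁ s₂} {T : Fin m → Tournament n} {D : Subset m} {x : ℚ} →
                 GoodBroom n m (converse ∘ T) ℓ (forward ℓ) s₁ s₂ D x → GoodBroom n m T ℓ (backward ℓ) s₁ s₂ D x
converse-broom G = record
  { f = f ; f-inj = f-inj ; φ = φ ; arcs = arcs ; avoidD = avoidD ; startCol = startCol ; endCol = endCol
  ; rainbow = rainbow
  ; tips = λ { v tip d d∈ true → tips v tip d d∈ false ; v tip d d∈ false → tips v tip d d∈ true }
  }
  where open GoodBroom G

module Brooms {n m : ℕ} (T : Fin m → Tournament n) (D : Subset m) (t : ℕ) {x : ℚ} (x≤t : x ≤ℚ ℕtoℚ t) where

  Dl : List (Fin m)
  Dl = elements D

  -- t + 52 neighbours off the path leave t neighbours off the broom, whose other vertices are the 52 tips.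
  GoodTip : List (Fin n) → Fin n → Set
  GoodTip Lf = Good T Lf (t + 52) Dl

  good-broom : ∀ {L} (S : Fin 2 → Fin n) (mids : Vec (Fin n) L) (E : Fin 50 → Fin n) (C : Vec (Fin m) (suc L))
    {Lf : List (Fin n)} → Injective _≡_ _≡_ S → Injective _≡_ _≡_ E →
    (∀ a b → RainbowPath T (S a) (E b) (S a ∷ (mids ∷ʳ E b)) C) → (∀ i → Vec.lookup C i ∉ Dl) →
    Unique Lf → (∀ i → Vec.lookup mids i ∉ Lf) → (∀ a → GoodTip Lf (S a)) → (∀ b → GoodTip Lf (E b)) →
    GoodBroom n m T (suc L) (forward (suc L)) 2 50 D x
  good-broom S mids E C {Lf} S-inj E-inj paths avoid uLf mids∉ S-good E-good =
    forward-broom T D x S mids E C S-inj E-inj paths (λ i → avoid i ∘ ∈-elements) (tip ∘ S-good) (tip ∘ E-good)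
    where
    f : BVert (suc _) 2 50 → Fin n
    f = broomVertex T D x S mids E C
    tips : List (Fin n)
    tips = tabulate S ++ tabulate E
    on-tips-or-off : ∀ u → f u ∈ tips ⊎ f u ∉ Lf
    on-tips-or-off (start a) = inj₁ (∈-++⁺ˡ (∈-tabulate⁺ {f = S} a))
    on-tips-or-off (mid i)   = inj₂ (mids∉ i)
    on-tips-or-off (end b)   = inj₁ (∈-++⁺ʳ (tabulate S) (∈-tabulate⁺ {f = E} b))
    tip : ∀ {w} → GoodTip Lf w → ∀ d → d ∈ₛ D → ∀ σ → NbrOutsideAtLeast (T d) σ w f x
    tip {w} good d d∈ σ = outDegree⇒NbrOutsideAtLeast (T d) σ w f uLf on-tips-or-off x≤t
                            (Good⇒outDegree T Lf (t + 52) good (∈-elements d∈) σ)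

  many-good : ∀ {Lf N : List (Fin n)} {q} → Unique Lf → Unique N → N ⊆ Lf → length N ≡ q →
              length Dl * (4 * (t + 52)) + 52 ≤ q → 52 ≤ length (filter (good? T Lf (t + 52) Dl) N)
  many-good {Lf} {N} {q} uLf uN N⊆ |N| q-big = +-cancelʳ-≤ B 52 _ (begin
    52 + B                                          ≡⟨ +-comm 52 B ⟩
    B + 52                                          ≤⟨ q-big ⟩
    q                                               ≡⟨ sym |N| ⟩
    length N                                        ≤⟨ good-count T Lf (t + 52) uLf Dl uN N⊆ ⟩
    length (filter (good? T Lf (t + 52) Dl) N) + B  ∎)
    where
    open ≤-Reasoning
    B : ℕ
    B = length Dl * (4 * (t + 52))

  short-broom : 2 + length Dl ≤ m → 203 + length Dl * (4 * (t + 52)) ≤ n → GoodBroom n m T 1 (forward 1) 2 50 D x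
  short-broom m-big n-big = let c , _ , _ , c∉ , _ = fresh-pair Dl m-big in
                            from-fan c∉ (common-out-fan (T c) 50 uG G-big)
    where
    G : List (Fin n)
    G = filter (good? T (allFin n) (t + 52) Dl) (allFin n)
    uG : Unique G
    uG = Unique.filter⁺ _ (Unique.allFin⁺ n)
    G-big : 2 * suc (2 * 50) < length G
    G-big = +-cancelʳ-≤ (length Dl * (4 * (t + 52))) 203 _ (≤-trans n-big (≤-trans (≤-reflexive (sym (length-tabulate id)))
              (good-count T (allFin n) (t + 52) (Unique.allFin⁺ n) Dl (Unique.allFin⁺ n) id)))
    good : ∀ {w} → w ∈ G → GoodTip (allFin n) w
    good = proj₂ ∘ ∈-filter⁻ _ {xs = allFin n}
    from-fan : ∀ {c} → c ∉ Dl → (∃ λ s₀ → ∃ λ s₁ → s₀ ∈ G × s₁ ∈ G × T c ∋ s₀ ⇒ s₁ ×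
                 Σ (OutFan (T c) s₁ 50) λ F → ∀ {y} → y ∈ OutFan.members F → y ∈ G × T c ∋ s₀ ⇒ y) →
               GoodBroom n m T 1 (forward 1) 2 50 D x
    from-fan {c} c∉ (s₀ , s₁ , s₀∈ , s₁∈ , s₀⇒s₁ , F , F⊆) =
      let E , E-inj , E∈F = pick 50 (OutFan.unique F) (≤-reflexive (sym (OutFan.size F))) in
      good-broom S [] E (c ∷ []) S-inj E-inj (λ a b → step c (S⇒ a (E∈F b)) (∉ᵥ-∷ (S≢ a (E∈F b)) λ ()) (λ ()) [ E b ])
                 (λ { zero → c∉ }) (Unique.allFin⁺ n) (λ ()) (good ∘ S∈G) (good ∘ proj₁ ∘ F⊆ ∘ E∈F)
      where
      S : Fin 2 → Fin n
      S zero    = s₀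
      S (suc _) = s₁
      S-inj : Injective _≡_ _≡_ S
      S-inj {zero}     {zero}     _  = refl
      S-inj {zero}     {suc zero} eq = contradiction (subst (T c ∋ s₀ ⇒_) (sym eq) s₀⇒s₁) (irrefl (T c) s₀)
      S-inj {suc zero} {zero}     eq = contradiction (subst (T c ∋ s₀ ⇒_) eq s₀⇒s₁) (irrefl (T c) s₀)
      S-inj {suc zero} {suc zero} _  = refl
      S∈G : ∀ a → S a ∈ G
      S∈G zero    = s₀∈
      S∈G (suc _) = s₁∈
      S⇒ : ∀ a {y} → y ∈ OutFan.members F → T c ∋ S a ⇒ y
      S⇒ zero    y∈ = proj₂ (F⊆ y∈)
      S⇒ (suc _) y∈ = OutFan.arcs F y∈
      S≢ : ∀ a {y} → y ∈ OutFan.members F → S a ≢ y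
      S≢ a y∈ refl = irrefl (T c) (S a) (S⇒ a y∈)

  module _ {cS cE : Fin m} (cS≢cE : cS ≢ cE) (cS∉ : cS ∉ Dl) (cE∉ : cE ∉ Dl) (q : ℕ)
           (q-big : length Dl * (4 * (t + 52)) + 52 ≤ q) where

    open PathGrowth T cS cE Dl q

    broom-from-state : ∀ {J} → State J → GoodBroom n m T (suc (suc J)) (forward (suc (suc J))) 2 50 D x
    broom-from-state st = from-tips (disjoint-picks 2 50 (Unique.filter⁺ _ (OutFan.unique inFan))
                                                        (Unique.filter⁺ _ (OutFan.unique outFan))
                                                        (≤-trans (m≤m+n 2 50) (fan-good {F = inFan} inFan-off)) (fan-good {F = outFan} outFan-off))
      where
      open State st
      Lf : List (Fin n)
      Lf = avoiding (Vec.toList vertices)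
      Candidates : List (Fin n) → List (Fin n)
      Candidates N = filter (good? T Lf (t + 52) Dl) N
      fan-good : ∀ {T′ w} {F : OutFan T′ w q} → (∀ {y} → y ∈ OutFan.members F → y ∉ᵥ vertices) →
                 52 ≤ length (Candidates (OutFan.members F))
      fan-good {F = F} off = many-good (avoiding-unique _) (OutFan.unique F) (∈-avoiding⁺ ∘ (_∘ ∈-toList⁻) ∘ off)
                                       (OutFan.size F) q-big
      candidate : ∀ N {w} → w ∈ Candidates N → w ∈ N × GoodTip Lf w
      candidate N = ∈-filter⁻ _ {xs = N}
      colours∉Dl : ∀ {c} → c ∈ᵥ cS ∷ (colours ∷ʳ cE) → c ∉ Dl
      colours∉Dl (here refl) = cS∉
      colours∉Dl (there c∈)  = [ (λ c∈cs c∈Dl → colours-allowed c∈cs (there (there c∈Dl))) , (λ { refl → cE∉ }) ]′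
                                 (∈ᵥ-∷ʳ⁻ colours c∈)
      from-tips : (Σ (Fin 2 → Fin n) λ S → Σ (Fin 50 → Fin n) λ E → Injective _≡_ _≡_ S × Injective _≡_ _≡_ E ×
                     (∀ a → S a ∈ Candidates (OutFan.members inFan)) × (∀ b → E b ∈ Candidates (OutFan.members outFan)) ×
                     (∀ a b → S a ≢ E b)) →
                  GoodBroom n m T _ (forward _) 2 50 D x
      from-tips (S , E , S-inj , E-inj , S∈ , E∈ , S≢E) =
        good-broom S vertices E (cS ∷ (colours ∷ʳ cE)) S-inj E-inj copy-path
                   (λ i → colours∉Dl (∈ᵥ-lookup i (cS ∷ (colours ∷ʳ cE)))) (avoiding-unique _)
                   (λ i v∈ → ∈-avoiding⁻ v∈ (∈-toList⁺ (∈ᵥ-lookup i vertices)))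
                   (proj₂ ∘ candidate (OutFan.members inFan) ∘ S∈) (proj₂ ∘ candidate (OutFan.members outFan) ∘ E∈)
        where
        copy-path : ∀ a b → RainbowPath T (S a) (E b) (S a ∷ (vertices ∷ʳ E b)) (cS ∷ (colours ∷ʳ cE))
        copy-path a b =
          path-snoc T (step cS (OutFan.arcs inFan S∈in) (inFan-off S∈in) (λ c∈ → colours-allowed c∈ (here refl)) path)
                      (OutFan.arcs outFan E∈out)
                      (∉ᵥ-∷ (S≢E a b ∘ sym) (outFan-off E∈out))
                      (∉ᵥ-∷ (cS≢cE ∘ sym) (λ c∈ → colours-allowed c∈ (there (here refl))))
          where
          S∈in : S a ∈ OutFan.members inFan
          S∈in = proj₁ (candidate (OutFan.members inFan) (S∈ a))
          E∈out : E b ∈ OutFan.members outFan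
          E∈out = proj₁ (candidate (OutFan.members outFan) (E∈ b))

  long-broom : ∀ J q → length Dl * (4 * (t + 52)) + 52 ≤ q → J + 8 * q + 2 ≤ n → length Dl + J + 4 ≤ m →
               GoodBroom n m T (suc (suc J)) (forward (suc (suc J))) 2 50 D x
  long-broom J q q-big n-big m-big =
    let cS , cE , cS≢cE , cS∉ , cE∉ = fresh-pair Dl (≤-trans (m≤m+n (2 + length Dl) (J + 2))
                                                             (≤-trans (≤-reflexive (regroup (length Dl) J)) m-big))
    in broom-from-state cS≢cE cS∉ cE∉ q q-big (PathGrowth.grow T cS cE Dl q J n-big m-big)
    where
    regroup : ∀ d j → 2 + d + (j + 2) ≡ d + j + 4
    regroup = solve-∀

-- Choice of the parameters

module Parameters (k ℓ₀ : ℕ) (ℓ₀-big : 4000 * k + 1000 ≤ ℓ₀) where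

  M : ℕ
  M = 64 * k

  -- t ≈ ℓ₀ / (M + 1): large enough that ε ℓ₀ ≤ t, small enough that 8 q ≤ ℓ₀.
  t : ℕ
  t = ℓ₀ / suc M + 1

  ℓ₀≤ : ℓ₀ ≤ suc M * t
  ℓ₀≤ = begin
    ℓ₀                                 ≡⟨ m≡m%n+[m/n]*n ℓ₀ (suc M) ⟩
    ℓ₀ % suc M + ℓ₀ / suc M * suc M    ≤⟨ +-monoˡ-≤ _ (<⇒≤ (m%n<n ℓ₀ (suc M))) ⟩
    suc M + ℓ₀ / suc M * suc M         ≡⟨ regroup (suc M) (ℓ₀ / suc M) ⟩
    suc M * t                          ∎
    where
    open ≤-Reasoning
    regroup : ∀ a d → a + d * a ≡ a * (d + 1)
    regroup = solve-∀

  ≤ℓ₀+ : suc M * t ≤ ℓ₀ + suc M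
  ≤ℓ₀+ = begin
    suc M * t                    ≡⟨ regroup (suc M) (ℓ₀ / suc M) ⟩
    ℓ₀ / suc M * suc M + suc M   ≤⟨ +-monoˡ-≤ (suc M) (m/n*n≤m ℓ₀ (suc M)) ⟩
    ℓ₀ + suc M                   ∎
    where
    open ≤-Reasoning
    regroup : ∀ a d → a * (d + 1) ≡ d * a + a
    regroup = solve-∀

  q : ℕ → ℕ
  q K = K * (4 * (t + 52)) + 52

  8q≤ℓ₀ : ∀ {K} → K ≤ k → 8 * q K ≤ ℓ₀
  8q≤ℓ₀ {K} K≤k = *-cancelˡ-≤ 2 (begin
    2 * (8 * q K)                         ≤⟨ *-monoʳ-≤ 2 (*-monoʳ-≤ 8 (+-monoˡ-≤ 52 (*-monoˡ-≤ (4 * (t + 52)) K≤k))) ⟩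
    2 * (8 * (k * (4 * (t + 52)) + 52))   ≡⟨ expand k t ⟩
    64 * k * t + (3328 * k + 832)         ≤⟨ +-monoˡ-≤ _ (≤-trans (*-monoˡ-≤ t (n≤1+n M)) ≤ℓ₀+) ⟩
    ℓ₀ + suc M + (3328 * k + 832)         ≡⟨ collect ℓ₀ k ⟩
    ℓ₀ + (3392 * k + 833)                 ≤⟨ +-monoʳ-≤ ℓ₀ (≤-trans (+-mono-≤ (*-monoˡ-≤ k (m≤m+n 3392 608)) (m≤m+n 833 167)) ℓ₀-big) ⟩
    ℓ₀ + ℓ₀                               ≡⟨ double ℓ₀ ⟩
    2 * ℓ₀                                ∎)
    where
    open ≤-Reasoning
    expand : ∀ k t → 2 * (8 * (k * (4 * (t + 52)) + 52)) ≡ 64 * k * t + (3328 * k + 832)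
    expand = solve-∀
    collect : ∀ l k → l + suc (64 * k) + (3328 * k + 832) ≡ l + (3392 * k + 833)
    collect = solve-∀
    double : ∀ l → l + l ≡ 2 * l
    double = solve-∀

  K+2≤ℓ₀ : ∀ {K} → K ≤ k → K + 2 ≤ ℓ₀
  K+2≤ℓ₀ {K} K≤k = ≤-trans (+-mono-≤ (≤-trans K≤k (m≤n*m k 4000)) (m≤m+n 2 998)) ℓ₀-big

module _ (k : ℕ) {ε : ℚ} (ε≤ : ε ≤ℚ 1/suc (64 * k)) (ℓ₀ : ℕ) (ℓ₀-big : 4000 * k + 1000 ≤ ℓ₀)
         {n m : ℕ} (T : Fin m → Tournament n) (D : Subset m) (|D|≤k : ∣ D ∣ ≤ k) where

  open Parameters k ℓ₀ ℓ₀-big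
  open Brooms T D t (≤1/suc⇒*ℕtoℚ≤ M ℓ₀ t ε≤ ℓ₀≤)

  |Dl|≤k : length Dl ≤ k
  |Dl|≤k = subst (_≤ k) (sym (length-elements D)) |D|≤k

  forward-case : ∀ ℓ → 1 ≤ ℓ → ℓ + ℓ₀ ≤ n → ℓ + ℓ₀ ≤ m → GoodBroom n m T ℓ (forward ℓ) 2 50 D (ε *ℚ ℕtoℚ ℓ₀)
  forward-case (suc zero) _ n-big m-big = short-broom
    (≤-trans (≤-reflexive (+-comm 2 (length Dl))) (≤-trans (K+2≤ℓ₀ |Dl|≤k) (≤-trans (n≤1+n ℓ₀) m-big)))
    (begin
      203 + B                  ≤⟨ m≤m+n (203 + B) (7 * B + 213) ⟩
      203 + B + (7 * B + 213)  ≡⟨ regroup B ⟩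
      8 * q (length Dl)        ≤⟨ 8q≤ℓ₀ |Dl|≤k ⟩
      ℓ₀                       ≤⟨ n≤1+n ℓ₀ ⟩
      1 + ℓ₀                   ≤⟨ n-big ⟩
      n                        ∎)
    where
    open ≤-Reasoning
    B : ℕ
    B = length Dl * (4 * (t + 52))
    regroup : ∀ B → 203 + B + (7 * B + 213) ≡ 8 * (B + 52)
    regroup = solve-∀
  forward-case (suc (suc J)) _ n-big m-big = long-broom J (q (length Dl)) ≤-refl
    (begin
      J + 8 * q (length Dl) + 2  ≡⟨ regroup J (8 * q (length Dl)) ⟩
      2 + J + 8 * q (length Dl)  ≤⟨ +-monoʳ-≤ (2 + J) (8q≤ℓ₀ |Dl|≤k) ⟩
      2 + J + ℓ₀                 ≤⟨ n-big ⟩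
      n                          ∎)
    (begin
      length Dl + J + 4          ≡⟨ regroup′ (length Dl) J ⟩
      2 + J + (length Dl + 2)    ≤⟨ +-monoʳ-≤ (2 + J) (K+2≤ℓ₀ |Dl|≤k) ⟩
      2 + J + ℓ₀                 ≤⟨ m-big ⟩
      m                          ∎)
    where
    open ≤-Reasoning
    regroup : ∀ j a → j + a + 2 ≡ 2 + j + a
    regroup = solve-∀
    regroup′ : ∀ d j → d + j + 4 ≡ 2 + j + (d + 2)
    regroup′ = solve-∀

lemma5p5 : (k : ℕ) → 1 ≤ k →
    Σ ℚ λ ε₀ → (0ℚ <ℚ ε₀) ×
      ((ε : ℚ) → 0ℚ <ℚ ε → ε ≤ℚ ε₀ →
        Σ ℕ λ L → (ℓ₀ : ℕ) → L ≤ ℓ₀ →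
          (ℓ : ℕ) → 1 ≤ ℓ → ℓ ≤ 10 * ℓ₀ →
          (n m : ℕ) → (T : Fin m → Tournament n) →
          ℓ + ℓ₀ ≤ n → ℓ + ℓ₀ ≤ m →
          (D : Subset m) → ∣ D ∣ ≤ k →
          (dir : Fin ℓ → Bool) → (dir ≡ forward ℓ ⊎ dir ≡ backward ℓ) →
          GoodBroom n m T ℓ dir 2 50 D (ε *ℚ ℕtoℚ ℓ₀))
lemma5p5 k _ = 1/suc (64 * k) , 1/suc-pos (64 * k) , λ ε _ ε≤ → 4000 * k + 1000 ,
  λ ℓ₀ ℓ₀-big ℓ 1≤ℓ _ n m T n-big m-big D |D|≤k → λ
    { _ (inj₁ refl) → forward-case k ε≤ ℓ₀ ℓ₀-big T D |D|≤k ℓ 1≤ℓ n-big m-big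
    ; _ (inj₂ refl) → converse-broom (forward-case k ε≤ ℓ₀ ℓ₀-big (converse ∘ T) D |D|≤k ℓ 1≤ℓ n-big m-big)
    }
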